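{- For every integer $n\ge1$, \[ R(n,n-1)=\sum_{m=1}^n (n-m)\,c(n,m), \] where $R(n,k)$ is the number of rooted forests on $[n]$ with exactly $k$ records and $c(n,m)$ is the unsigned Stirling number of the first kind.
   Context: A rooted forest on $[n]=\{1,\dots,n\}$ is a set of labeled rooted trees whose vertex sets partition $[n]$. A vertex is a record if its label is the largest on the path from it to the root of its tree (inclusive). $c(n,m)$ is the number of permutations of $[n]$ with exactly $m$ cycles. -}

module Defs where

open import Data.Nat using (ℕ; zero; suc; _∸_; _*_; _≤ᵇ_; _≡ᵇ_)
open import Data.Bool using (Bool; true; false; _∧_; not)
open import Data.Fin using (Fin; toℕ)
open import Data.Maybe using (Maybe; nothing; just; maybe)
open import Data.List using (List; []; _∷_; [_]; map; concatMap; length; filterᵇ; allFin; applyUpTo)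
open import Data.Bool.ListAction using (all)
open import Data.Nat.ListAction using (sum)
open import Data.Vec as V using (Vec; lookup)

allVecs : {A : Set} → List A → (k : ℕ) → List (Vec A k)
allVecs xs zero    = [ V.[] ]
allVecs xs (suc k) = concatMap (λ x → map (x V.∷_) (allVecs xs k)) xs

count : {A : Set} → (A → Bool) → List A → ℕ
count p xs = length (filterᵇ p xs)

-- Rooted forests on [n], vertices labelled by Fin n (label i ↔ i+1,
-- order preserving).  A rooted forest is encoded by its parent map:
-- parent v = nothing iff v is a root.

ParentMap : ℕ → Set
ParentMap n = Vec (Maybe (Fin n)) n

allParentMaps : (n : ℕ) → List (ParentMap n)
allParentMaps n = allVecs (nothing ∷ map just (allFin n)) n

reaches : ∀ {n} → ParentMap n → ℕ → Fin n → Bool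
reaches p zero    v = false
reaches p (suc f) v = maybe (reaches p f) true (lookup p v)

path : ∀ {n} → ParentMap n → ℕ → Fin n → List (Fin n)
path p zero    v = []
path p (suc f) v = v ∷ maybe (path p f) [] (lookup p v)

-- acyclic: every vertex reaches a root (a root path has ≤ n vertices)
isForest : ∀ {n} → ParentMap n → Bool
isForest {n} p = all (reaches p n) (allFin n)

isRecord : ∀ {n} → ParentMap n → Fin n → Bool
isRecord {n} p v = all (λ u → toℕ u ≤ᵇ toℕ v) (path p n v)

numRecords : ∀ {n} → ParentMap n → ℕ
numRecords {n} p = count (isRecord p) (allFin n)

R : ℕ → ℕ → ℕ
R n k = count (λ p → isForest p ∧ (numRecords p ≡ᵇ k)) (allParentMaps n)

Perm : ℕ → Set
Perm n = Vec (Fin n) n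

allMaps : (n : ℕ) → List (Perm n)
allMaps n = allVecs (allFin n) n

isPerm : ∀ {n} → Perm n → Bool
isPerm {n} σ = all (λ i → all (λ j → (toℕ i ≡ᵇ toℕ j) ∨' not (toℕ (lookup σ i) ≡ᵇ toℕ (lookup σ j))) (allFin n)) (allFin n)
  where
  _∨'_ : Bool → Bool → Bool
  true  ∨' _ = true
  false ∨' b = b

iter : ∀ {n} → Perm n → ℕ → Fin n → Fin n
iter σ zero    i = i
iter σ (suc j) i = lookup σ (iter σ j i)

-- i is the least element of its cycle (σ^j i ≥ i for j = 1..n, which
-- covers the whole cycle); each cycle has exactly one such element
isCycleMin : ∀ {n} → Perm n → Fin n → Bool
isCycleMin {n} σ i = all (λ j → toℕ i ≤ᵇ toℕ (iter σ j i)) (applyUpTo suc n)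

numCycles : ∀ {n} → Perm n → ℕ
numCycles {n} σ = count (isCycleMin σ) (allFin n)

c : ℕ → ℕ → ℕ
c n m = count (λ σ → isPerm σ ∧ (numCycles σ ≡ᵇ m)) (allMaps n)

rhs : ℕ → ℕ
rhs n = sum (map (λ m → (n ∸ m) * c n m) (applyUpTo suc n))

{-# OPTIONS --safe #-}
module Submission where

-- Both sides equal ∑_{u<n} u · n!/(u+1), with labels 0, …, n−1.
--
-- A forest has the single non-record v exactly when v hangs below some u > v, every other
-- vertex is a root or hangs below a smaller label, and only labels above u hang below v.
-- Choosing parents vertex by vertex gives n!/(u+1) such forests for each of the u choices of v.
--
-- The right-hand side counts the pairs (σ, i) in which i is not the least element of its cycle.
-- Let S_k be the permutations fixing every point ≥ k. With j = τ⁻¹ k, τ ↦ (j , τ ∘ (j k)) is a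
-- bijection S_{k+1} ≅ {0, …, k} × S_k which keeps the cycle-minimum status of every i ≠ k, while
-- k stays a cycle minimum only when j = k. By induction on k, i fails to be a cycle minimum in
-- exactly i · n!/(i+1) permutations of S_n.

open import Defs
open import Data.Nat using (ℕ; _≤_; _∸_)
open import Relation.Binary.PropositionalEquality using (_≡_)

open import Data.Bool using (Bool; true; false; T; not; _∧_; _∨_)
open import Data.Bool.ListAction using (all)
open import Data.Bool.Properties using (T-∧; T-∨; ∧-assoc; ∧-comm; ∧-identityʳ)
open import Data.Empty using (⊥-elim)
open import Data.Fin as Fin using (Fin; toℕ)
open import Data.Fin.Permutation.Components using (transpose; transpose-inverse)
open import Data.Fin.Properties using (toℕ<n; toℕ-injective; toℕ-fromℕ<; pigeonhole)
open import Data.List using (List; []; _∷_; map; _++_; concatMap; allFin; tabulate; applyUpTo; length)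
open import Data.List.Membership.Propositional using (_∈_)
open import Data.List.Membership.Propositional.Properties using (∈-applyUpTo⁺)
open import Data.List.Properties using (length-tabulate)
open import Data.List.Relation.Unary.All as All using (All; []; _∷_)
open import Data.List.Relation.Unary.All.Properties using (all⁺; all⁻; tabulate⁺; tabulate⁻; applyUpTo⁺₁)
open import Data.List.Relation.Unary.All.Properties.Core using (¬All⇒Any¬)
open import Data.List.Relation.Unary.Any using (here; there; satisfied)
open import Data.Maybe using (Maybe; nothing; just; maybe)
open import Data.Maybe.Properties using (just-injective)
open import Data.Nat using (zero; suc; pred; _+_; _*_; _!; _⊓_; _<_; _≡ᵇ_; _<ᵇ_; _≤ᵇ_; _<?_; _≤?_; z≤n; s≤s; s≤s⁻¹; >-nonZero)
open import Data.Nat.ListAction using (sum)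
open import Data.Nat.Properties
open import Algebra.Properties.CommutativeSemigroup +-commutativeSemigroup using (interchange)
open import Data.Product using (Σ; _×_; _,_; proj₁; proj₂)
open import Data.Sum using (_⊎_; inj₁; inj₂)
open import Data.Vec as Vec using (Vec; lookup)
open import Data.Vec.Properties using (≡-dec; lookup∘tabulate; tabulate∘lookup; tabulate-cong)
open import Function using (_∘_; id)
open import Function.Bundles using (Equivalence)
open import Function.Definitions using (Injective)
open import Relation.Binary.Definitions using (DecidableEquality; tri<; tri≈; tri>)
open import Relation.Binary.PropositionalEquality using (refl; sym; trans; cong; cong₂; subst; subst₂; _≢_; module ≡-Reasoning)
open import Relation.Nullary using (¬_; Dec; does; yes; no)
open import Relation.Nullary.Decidable using (T?; dec-true; dec-false)

𝟙 : Bool → ℕ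
𝟙 true  = 1
𝟙 false = 0

𝟙-T : ∀ {b} → T b → 𝟙 b ≡ 1
𝟙-T {true} _ = refl

𝟙-¬T : ∀ {b} → ¬ T b → 𝟙 b ≡ 0
𝟙-¬T {true}  ¬b = ⊥-elim (¬b _)
𝟙-¬T {false} _  = refl

T-not⁻ : ∀ {b} → T (not b) → ¬ T b
T-not⁻ {true} ()

T-not⁺ : ∀ {b} → ¬ T b → T (not b)
T-not⁺ {true}  ¬b = ¬b _
T-not⁺ {false} _  = _

T-∧⁻ : ∀ {a b} → T (a ∧ b) → T a × T b
T-∧⁻ = Equivalence.to T-∧

T-∧⁺ : ∀ {a b} → T a → T b → T (a ∧ b)
T-∧⁺ ta tb = Equivalence.from T-∧ (ta , tb)

T-≡ : ∀ {a b} → (T a → T b) → (T b → T a) → a ≡ b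
T-≡ {true}  {true}  _   _   = refl
T-≡ {true}  {false} a⇒b _   = ⊥-elim (a⇒b _)
T-≡ {false} {true}  _   b⇒a = ⊥-elim (b⇒a _)
T-≡ {false} {false} _   _   = refl

T-does⁻ : ∀ {P : Set} (d : Dec P) → T (does d) → P
T-does⁻ (yes p) _ = p

T-does⁺ : ∀ {P : Set} (d : Dec P) → P → T (does d)
T-does⁺ (yes _) _ = _
T-does⁺ (no ¬p) p = ¬p p

𝟙-∧ : ∀ a b → 𝟙 (a ∧ b) ≡ 𝟙 a * 𝟙 b
𝟙-∧ true  b = sym (+-identityʳ (𝟙 b))
𝟙-∧ false b = refl

𝟙*-cong : ∀ b {x y} → (T b → x ≡ y) → 𝟙 b * x ≡ 𝟙 b * y
𝟙*-cong true  x≡y = cong (_+ 0) (x≡y _)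
𝟙*-cong false _   = refl

𝟙-not : ∀ b → 𝟙 b + 𝟙 (not b) ≡ 1
𝟙-not true  = refl
𝟙-not false = refl

-- Finite sums and products

sumOver : {A : Set} → List A → (A → ℕ) → ℕ
sumOver []       f = 0
sumOver (x ∷ xs) f = f x + sumOver xs f

syntax sumOver xs (λ x → e) = ∑[ x ∈ xs ] e

private variable A B : Set

∑-cong : ∀ {f g : A → ℕ} (xs : List A) → (∀ x → f x ≡ g x) → ∑[ x ∈ xs ] f x ≡ ∑[ x ∈ xs ] g x
∑-cong []       f≗g = refl
∑-cong (x ∷ xs) f≗g = cong₂ _+_ (f≗g x) (∑-cong xs f≗g)

∑-zero : ∀ (xs : List A) → ∑[ x ∈ xs ] 0 ≡ 0
∑-zero []       = refl
∑-zero (x ∷ xs) = ∑-zero xs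

∑-distrib-+ : ∀ (f g : A → ℕ) xs → ∑[ x ∈ xs ] (f x + g x) ≡ ∑[ x ∈ xs ] f x + ∑[ x ∈ xs ] g x
∑-distrib-+ f g []       = refl
∑-distrib-+ f g (x ∷ xs) = trans (cong (f x + g x +_) (∑-distrib-+ f g xs)) (interchange (f x) (g x) _ _)

*-distribˡ-∑ : ∀ c (f : A → ℕ) xs → c * ∑[ x ∈ xs ] f x ≡ ∑[ x ∈ xs ] (c * f x)
*-distribˡ-∑ c f []       = *-zeroʳ c
*-distribˡ-∑ c f (x ∷ xs) = trans (*-distribˡ-+ c (f x) _) (cong (c * f x +_) (*-distribˡ-∑ c f xs))

*-distribʳ-∑ : ∀ c (f : A → ℕ) xs → (∑[ x ∈ xs ] f x) * c ≡ ∑[ x ∈ xs ] (f x * c)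
*-distribʳ-∑ c f xs = trans (*-comm _ c)
  (trans (*-distribˡ-∑ c f xs) (∑-cong xs (λ x → *-comm c (f x))))

∑-++ : ∀ (f : A → ℕ) xs ys → ∑[ x ∈ xs ++ ys ] f x ≡ ∑[ x ∈ xs ] f x + ∑[ x ∈ ys ] f x
∑-++ f []       ys = refl
∑-++ f (x ∷ xs) ys = trans (cong (f x +_) (∑-++ f xs ys)) (sym (+-assoc (f x) _ _))

∑-map : (f : B → ℕ) (g : A → B) (xs : List A) → ∑[ y ∈ map g xs ] f y ≡ ∑[ x ∈ xs ] f (g x)
∑-map f g []       = refl
∑-map f g (x ∷ xs) = cong (f (g x) +_) (∑-map f g xs)

∑-concatMap : (f : B → ℕ) (g : A → List B) (xs : List A) →
              ∑[ y ∈ concatMap g xs ] f y ≡ ∑[ x ∈ xs ] ∑[ y ∈ g x ] f y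
∑-concatMap f g []       = refl
∑-concatMap f g (x ∷ xs) = trans (∑-++ f (g x) (concatMap g xs)) (cong (_ +_) (∑-concatMap f g xs))

∑-comm : (f : A → B → ℕ) (xs : List A) (ys : List B) →
         ∑[ x ∈ xs ] ∑[ y ∈ ys ] f x y ≡ ∑[ y ∈ ys ] ∑[ x ∈ xs ] f x y
∑-comm f []       ys = sym (∑-zero ys)
∑-comm f (x ∷ xs) ys = trans (cong (_ +_) (∑-comm f xs ys)) (sym (∑-distrib-+ (f x) _ ys))

∑-𝟙-complement : ∀ (b : A → Bool) xs → ∑[ x ∈ xs ] 𝟙 (b x) + ∑[ x ∈ xs ] 𝟙 (not (b x)) ≡ length xs
∑-𝟙-complement b []       = refl
∑-𝟙-complement b (x ∷ xs) = trans (interchange (𝟙 (b x)) _ (𝟙 (not (b x))) _)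
                                  (cong₂ _+_ (𝟙-not (b x)) (∑-𝟙-complement b xs))

∑-allFin-complement : ∀ n (b : Fin n → Bool) → ∑[ x ∈ allFin n ] 𝟙 (b x) + ∑[ x ∈ allFin n ] 𝟙 (not (b x)) ≡ n
∑-allFin-complement n b = trans (∑-𝟙-complement b (allFin n)) (length-tabulate {n = n} id)

count≡∑𝟙 : ∀ (p : A → Bool) xs → count p xs ≡ ∑[ x ∈ xs ] 𝟙 (p x)
count≡∑𝟙 p []       = refl
count≡∑𝟙 p (x ∷ xs) with p x
... | true  = cong suc (count≡∑𝟙 p xs)
... | false = count≡∑𝟙 p xs

sumBelow : ℕ → (ℕ → ℕ) → ℕ
sumBelow zero    f = 0
sumBelow (suc n) f = sumBelow n f + f n

prodBelow : ℕ → (ℕ → ℕ) → ℕ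
prodBelow zero    f = 1
prodBelow (suc n) f = prodBelow n f * f n

syntax sumBelow n (λ k → e) = ∑[ k < n ] e
syntax prodBelow n (λ k → e) = ∏[ k < n ] e

∑<-cong : ∀ n {f g : ℕ → ℕ} → (∀ k → k < n → f k ≡ g k) → ∑[ k < n ] f k ≡ ∑[ k < n ] g k
∑<-cong zero    f≗g = refl
∑<-cong (suc n) f≗g = cong₂ _+_ (∑<-cong n (λ k k<n → f≗g k (m<n⇒m<1+n k<n))) (f≗g n ≤-refl)

∏<-cong : ∀ n {f g : ℕ → ℕ} → (∀ k → k < n → f k ≡ g k) → ∏[ k < n ] f k ≡ ∏[ k < n ] g k
∏<-cong zero    f≗g = refl
∏<-cong (suc n) f≗g = cong₂ _*_ (∏<-cong n (λ k k<n → f≗g k (m<n⇒m<1+n k<n))) (f≗g n ≤-refl)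

∑<-const : ∀ n c → ∑[ k < n ] c ≡ n * c
∑<-const zero    c = refl
∑<-const (suc n) c = trans (cong (_+ c) (∑<-const n c)) (+-comm (n * c) c)

∑<-vanish : ∀ n {f : ℕ → ℕ} → (∀ k → k < n → f k ≡ 0) → ∑[ k < n ] f k ≡ 0
∑<-vanish n f≗0 = trans (∑<-cong n f≗0) (trans (∑<-const n 0) (*-zeroʳ n))

∑<-distrib-+ : ∀ n (f g : ℕ → ℕ) → ∑[ k < n ] (f k + g k) ≡ ∑[ k < n ] f k + ∑[ k < n ] g k
∑<-distrib-+ zero    f g = refl
∑<-distrib-+ (suc n) f g = trans (cong (_+ (f n + g n)) (∑<-distrib-+ n f g)) (interchange (∑[ k < n ] f k) (∑[ k < n ] g k) (f n) (g n))

∑<-front : ∀ n (f : ℕ → ℕ) → ∑[ k < suc n ] f k ≡ f 0 + ∑[ k < n ] f (suc k)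
∑<-front zero    f = +-comm 0 (f 0)
∑<-front (suc n) f = trans (cong (_+ f (suc n)) (∑<-front n f)) (+-assoc (f 0) _ _)

sum-map-applyUpTo : ∀ (f g : ℕ → ℕ) n → sum (map f (applyUpTo g n)) ≡ ∑[ k < n ] f (g k)
sum-map-applyUpTo f g zero    = refl
sum-map-applyUpTo f g (suc n) = trans (cong (f (g 0) +_) (sum-map-applyUpTo f (g ∘ suc) n)) (sym (∑<-front n (f ∘ g)))

∏<-front : ∀ n (f : ℕ → ℕ) → ∏[ k < suc n ] f k ≡ f 0 * ∏[ k < n ] f (suc k)
∏<-front zero    f = trans (*-identityˡ (f 0)) (sym (*-identityʳ (f 0)))
∏<-front (suc n) f = trans (cong (_* f (suc n)) (∏<-front n f)) (*-assoc (f 0) _ _)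

∏-suc≡! : ∀ m → ∏[ k < m ] suc k ≡ m !
∏-suc≡! zero    = refl
∏-suc≡! (suc m) = trans (cong (_* suc m) (∏-suc≡! m)) (*-comm (m !) (suc m))

∑<-single : ∀ n (f : ℕ → ℕ) {a} → a < n → (∀ k → k < n → k ≢ a → f k ≡ 0) → ∑[ k < n ] f k ≡ f a
∑<-single (suc n) f {a} a<1+n f≗0 with a ≟ n
... | yes refl = cong (_+ f a) (∑<-vanish a (λ k k<a → f≗0 k (m<n⇒m<1+n k<a) (<⇒≢ k<a)))
... | no a≢n   = trans (cong₂ _+_ (∑<-single n f (≤∧≢⇒< (s≤s⁻¹ a<1+n) a≢n)
                                     (λ k k<n → f≗0 k (m<n⇒m<1+n k<n)))
                                   (f≗0 n ≤-refl (a≢n ∘ sym)))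
                       (+-identityʳ (f a))

∑-∑<-comm : ∀ n (f : ℕ → A → ℕ) xs → ∑[ x ∈ xs ] ∑[ k < n ] f k x ≡ ∑[ k < n ] ∑[ x ∈ xs ] f k x
∑-∑<-comm zero    f xs = ∑-zero xs
∑-∑<-comm (suc n) f xs = trans (∑-distrib-+ (λ x → ∑[ k < n ] f k x) (f n) xs)
                               (cong (_+ ∑[ x ∈ xs ] f n x) (∑-∑<-comm n f xs))

∑-tabulate : ∀ n (g : Fin n → A) (h : A → ℕ) (f : ℕ → ℕ) →
             (∀ i → h (g i) ≡ f (toℕ i)) → ∑[ x ∈ tabulate g ] h x ≡ ∑[ k < n ] f k
∑-tabulate zero    g h f hg≗f = refl
∑-tabulate (suc n) g h f hg≗f = trans (cong₂ _+_ (hg≗f Fin.zero) (∑-tabulate n (g ∘ Fin.suc) h (f ∘ suc) (hg≗f ∘ Fin.suc)))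
                                      (sym (∑<-front n f))

∑-allFin : ∀ n (f : ℕ → ℕ) → ∑[ i ∈ allFin n ] f (toℕ i) ≡ ∑[ k < n ] f k
∑-allFin n f = ∑-tabulate n (λ i → i) (f ∘ toℕ) f (λ _ → refl)

∑-𝟙≡0⇒All¬ : ∀ (c : A → Bool) xs → ∑[ x ∈ xs ] 𝟙 (c x) ≡ 0 → All (λ x → ¬ T (c x)) xs
∑-𝟙≡0⇒All¬ c []       _   = []
∑-𝟙≡0⇒All¬ c (x ∷ xs) sum≡0 with c x in eq
... | false = (λ cx → subst T eq cx) ∷ ∑-𝟙≡0⇒All¬ c xs sum≡0

∑-𝟙≡1⇒unique : ∀ {n} (c : A → Bool) (f : Fin n → A) → ∑[ x ∈ tabulate f ] 𝟙 (c x) ≡ 1 →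
        Σ (Fin n) λ i → T (c (f i)) × (∀ j → T (c (f j)) → j ≡ i)
∑-𝟙≡1⇒unique {n = suc n} c f sum≡1 with c (f Fin.zero) in eq
... | true  = Fin.zero , subst T (sym eq) _ , unique
  where
  unique : ∀ j → T (c (f j)) → j ≡ Fin.zero
  unique Fin.zero    _  = refl
  unique (Fin.suc j) cj = ⊥-elim (tabulate⁻ (∑-𝟙≡0⇒All¬ c (tabulate (f ∘ Fin.suc)) (suc-injective sum≡1)) j cj)
... | false with ∑-𝟙≡1⇒unique c (f ∘ Fin.suc) sum≡1
...   | i , ci , unique = Fin.suc i , ci , unique′
  where
  unique′ : ∀ j → T (c (f j)) → j ≡ Fin.suc i
  unique′ Fin.zero    cj = ⊥-elim (subst T eq cj)
  unique′ (Fin.suc j) cj = cong Fin.suc (unique j cj)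

∑<-𝟙-≡ : ∀ n {u} → u < n → ∑[ j < n ] 𝟙 (j ≡ᵇ u) ≡ 1
∑<-𝟙-≡ n {u} u<n = trans (∑<-single n _ u<n (λ j _ j≢u → 𝟙-¬T (j≢u ∘ ≡ᵇ⇒≡ j u))) (𝟙-T (≡⇒≡ᵇ u u refl))

∑<-𝟙-< : ∀ n k → ∑[ j < n ] 𝟙 (j <ᵇ k) ≡ n ⊓ k
∑<-𝟙-< zero    k = refl
∑<-𝟙-< (suc n) k with n <? k
... | yes n<k = trans (cong₂ _+_ (trans (∑<-𝟙-< n k) (m≤n⇒m⊓n≡m (<⇒≤ n<k))) (𝟙-T (<⇒<ᵇ n<k)))
                      (trans (+-comm n 1) (sym (m≤n⇒m⊓n≡m n<k)))
... | no n≮k  = trans (cong₂ _+_ (trans (∑<-𝟙-< n k) (m≥n⇒m⊓n≡n (≮⇒≥ n≮k))) (𝟙-¬T (n≮k ∘ <ᵇ⇒< n k)))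
                      (trans (+-identityʳ k) (sym (m≥n⇒m⊓n≡n (m≤n⇒m≤1+n (≮⇒≥ n≮k)))))

∑<-𝟙-<-≢ : ∀ n {k v} → k ≤ n → v < n → ∑[ j < n ] 𝟙 ((j <ᵇ k) ∧ not (j ≡ᵇ v)) ≡ k ∸ 𝟙 (v <ᵇ k)
∑<-𝟙-<-≢ n {k} {v} k≤n v<n = trans (sym (m+n∸n≡m others (𝟙 (v <ᵇ k)))) (cong (_∸ 𝟙 (v <ᵇ k)) (begin
  others + 𝟙 (v <ᵇ k)                                                   ≡⟨ cong (others +_) only-v ⟨
  others + ∑[ j < n ] 𝟙 ((j <ᵇ k) ∧ (j ≡ᵇ v))                           ≡⟨ ∑<-distrib-+ n _ _ ⟨
  ∑[ j < n ] (𝟙 ((j <ᵇ k) ∧ not (j ≡ᵇ v)) + 𝟙 ((j <ᵇ k) ∧ (j ≡ᵇ v)))  ≡⟨ ∑<-cong n (λ j _ → split (j <ᵇ k) (j ≡ᵇ v)) ⟩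
  ∑[ j < n ] 𝟙 (j <ᵇ k)                                                 ≡⟨ ∑<-𝟙-< n k ⟩
  n ⊓ k                                                                 ≡⟨ m≥n⇒m⊓n≡n k≤n ⟩
  k                                                                     ∎))
  where
  open ≡-Reasoning
  others = ∑[ j < n ] 𝟙 ((j <ᵇ k) ∧ not (j ≡ᵇ v))
  split : ∀ a b → 𝟙 (a ∧ not b) + 𝟙 (a ∧ b) ≡ 𝟙 a
  split true  b = trans (+-comm (𝟙 (not b)) (𝟙 b)) (𝟙-not b)
  split false b = refl
  only-v : ∑[ j < n ] 𝟙 ((j <ᵇ k) ∧ (j ≡ᵇ v)) ≡ 𝟙 (v <ᵇ k)
  only-v = trans (∑<-single n _ v<n (λ j _ j≢v → trans (𝟙-∧ (j <ᵇ k) (j ≡ᵇ v))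
                                                        (trans (cong (𝟙 (j <ᵇ k) *_) (𝟙-¬T (j≢v ∘ ≡ᵇ⇒≡ j v))) (*-zeroʳ (𝟙 (j <ᵇ k))))))
                 (trans (𝟙-∧ (v <ᵇ k) (v ≡ᵇ v)) (trans (cong (𝟙 (v <ᵇ k) *_) (𝟙-T (≡⇒≡ᵇ v v refl))) (*-identityʳ _)))

∏<-telescope : ∀ n (f g c : ℕ → ℕ) → (∀ k → k < n → f k * c (suc k) ≡ c k * g k) →
               ∏[ k < n ] f k * c n ≡ c 0 * ∏[ k < n ] g k
∏<-telescope zero    f g c _    = *-comm 1 (c 0)
∏<-telescope (suc n) f g c step = begin
  ∏[ k < n ] f k * f n * c (suc n)    ≡⟨ *-assoc (∏[ k < n ] f k) (f n) (c (suc n)) ⟩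
  ∏[ k < n ] f k * (f n * c (suc n))  ≡⟨ cong (∏[ k < n ] f k *_) (step n ≤-refl) ⟩
  ∏[ k < n ] f k * (c n * g n)        ≡⟨ *-assoc (∏[ k < n ] f k) (c n) (g n) ⟨
  ∏[ k < n ] f k * c n * g n          ≡⟨ cong (_* g n) (∏<-telescope n f g c (λ k k<n → step k (m<n⇒m<1+n k<n))) ⟩
  c 0 * ∏[ k < n ] g k * g n          ≡⟨ *-assoc (c 0) (∏[ k < n ] g k) (g n) ⟩
  c 0 * ∏[ k < suc n ] g k            ∎
  where open ≡-Reasoning

omitFactor : ℕ → ℕ → ℕ
omitFactor u k with k ≟ u
... | yes _ = 1
... | no _  = suc k

replaceFactor : ℕ → ℕ → ℕ
replaceFactor u k with k ≟ u
... | yes _ = u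
... | no _  = suc k

omitFactor-at : ∀ u → omitFactor u u ≡ 1
omitFactor-at u with u ≟ u
... | yes _  = refl
... | no u≢u = ⊥-elim (u≢u refl)

omitFactor-≢ : ∀ {u k} → k ≢ u → omitFactor u k ≡ suc k
omitFactor-≢ {u} {k} k≢u with k ≟ u
... | yes k≡u = ⊥-elim (k≢u k≡u)
... | no _    = refl

replaceFactor-at : ∀ u → replaceFactor u u ≡ u
replaceFactor-at u with u ≟ u
... | yes _  = refl
... | no u≢u = ⊥-elim (u≢u refl)

replaceFactor-≢ : ∀ {u k} → k ≢ u → replaceFactor u k ≡ suc k
replaceFactor-≢ {u} {k} k≢u with k ≟ u
... | yes k≡u = ⊥-elim (k≢u k≡u)
... | no _    = refl

factorialOmitting : ℕ → ℕ → ℕ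
factorialOmitting n u = ∏[ k < n ] omitFactor u k

factorialReplacing : ℕ → ℕ → ℕ
factorialReplacing n u = ∏[ k < n ] replaceFactor u k

factorialReplacing≡ : ∀ {n u} → u < n → factorialReplacing n u ≡ u * factorialOmitting n u
factorialReplacing≡ {n} {u} u<n = begin
  factorialReplacing n u               ≡⟨ *-identityʳ _ ⟨
  factorialReplacing n u * 1           ≡⟨ cong (factorialReplacing n u *_) (scale-above u<n) ⟨
  factorialReplacing n u * scale n     ≡⟨ ∏<-telescope n (replaceFactor u) (omitFactor u) scale telescopes ⟩
  scale 0 * factorialOmitting n u      ≡⟨ cong (_* factorialOmitting n u) (scale-≤ z≤n) ⟩
  u * factorialOmitting n u            ∎
  where
  open ≡-Reasoning
  scale : ℕ → ℕ
  scale k with k ≤? u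
  ... | yes _ = u
  ... | no _  = 1
  scale-≤ : ∀ {k} → k ≤ u → scale k ≡ u
  scale-≤ {k} k≤u with k ≤? u
  ... | yes _  = refl
  ... | no k≰u = ⊥-elim (k≰u k≤u)
  scale-above : ∀ {k} → u < k → scale k ≡ 1
  scale-above {k} u<k with k ≤? u
  ... | yes k≤u = ⊥-elim (<⇒≱ u<k k≤u)
  ... | no _    = refl
  telescopes : ∀ k → k < n → replaceFactor u k * scale (suc k) ≡ scale k * omitFactor u k
  telescopes k _ with <-cmp k u
  ... | tri< k<u _ _ rewrite replaceFactor-≢ (<⇒≢ k<u) | omitFactor-≢ (<⇒≢ k<u) | scale-≤ k<u | scale-≤ (<⇒≤ k<u) =
        *-comm (suc k) u
  ... | tri≈ _ refl _ rewrite replaceFactor-at k | omitFactor-at k | scale-above (n<1+n k) | scale-≤ (≤-refl {k}) = refl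
  ... | tri> _ _ u<k rewrite replaceFactor-≢ (>⇒≢ u<k) | omitFactor-≢ (>⇒≢ u<k) | scale-above (m<n⇒m<1+n u<k)
                           | scale-above u<k = *-comm (suc k) 1

module Enumeration (_≟_ : DecidableEquality A) where

  multiplicity : A → List A → ℕ
  multiplicity a xs = ∑[ x ∈ xs ] 𝟙 (does (x ≟ a))

  Enumerates : List A → Set
  Enumerates xs = ∀ a → multiplicity a xs ≡ 1

  ∑-sift : ∀ (f : A → ℕ) a xs → ∑[ x ∈ xs ] (𝟙 (does (x ≟ a)) * f x) ≡ multiplicity a xs * f a
  ∑-sift f a []       = refl
  ∑-sift f a (x ∷ xs) with x ≟ a
  ... | yes refl = cong₂ _+_ (+-identityʳ (f x)) (∑-sift f a xs)
  ... | no _     = ∑-sift f a xs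

  ∑-reindex : ∀ {xs} → Enumerates xs → (f g : A → A) → (∀ x → g (f x) ≡ x) → (∀ y → f (g y) ≡ y) →
              (w : A → ℕ) → ∑[ x ∈ xs ] w (f x) ≡ ∑[ y ∈ xs ] w y
  -- Both sides equal ∑_{x,y} [y = f x] w y.
  ∑-reindex {xs} enum f g gf fg w = begin
    ∑[ x ∈ xs ] w (f x)                                   ≡⟨ ∑-cong xs (λ x → sym (sifted (f x))) ⟩
    ∑[ x ∈ xs ] ∑[ y ∈ xs ] (𝟙 (does (y ≟ f x)) * w y)   ≡⟨ ∑-comm _ xs xs ⟩
    ∑[ y ∈ xs ] ∑[ x ∈ xs ] (𝟙 (does (y ≟ f x)) * w y)   ≡⟨ ∑-cong xs (λ y → ∑-cong xs (λ x → cong (λ b → 𝟙 b * w y) (swap-sides x y))) ⟩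
    ∑[ y ∈ xs ] ∑[ x ∈ xs ] (𝟙 (does (x ≟ g y)) * w y)   ≡⟨ ∑-cong xs (λ y → sym (*-distribʳ-∑ (w y) _ xs)) ⟩
    ∑[ y ∈ xs ] (multiplicity (g y) xs * w y)             ≡⟨ ∑-cong xs (λ y → trans (cong (_* w y) (enum (g y))) (*-identityˡ (w y))) ⟩
    ∑[ y ∈ xs ] w y                                       ∎
    where
    open ≡-Reasoning
    sifted : ∀ a → ∑[ y ∈ xs ] (𝟙 (does (y ≟ a)) * w y) ≡ w a
    sifted a = trans (∑-sift w a xs) (trans (cong (_* w a) (enum a)) (*-identityˡ (w a)))
    swap-sides : ∀ x y → does (y ≟ f x) ≡ does (x ≟ g y)
    swap-sides x y with y ≟ f x | x ≟ g y
    ... | yes _    | yes _    = refl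
    ... | no _     | no _     = refl
    ... | yes y≡fx | no x≢gy  = ⊥-elim (x≢gy (trans (sym (gf x)) (cong g (sym y≡fx))))
    ... | no y≢fx  | yes x≡gy = ⊥-elim (y≢fx (trans (sym (fg y)) (cong f (sym x≡gy))))

open Enumeration public

allFin-enumerates : ∀ n → Enumerates Fin._≟_ (allFin n)
allFin-enumerates n a = begin
  ∑[ x ∈ allFin n ] 𝟙 (does (x Fin.≟ a))  ≡⟨ ∑-tabulate n id _ (λ k → 𝟙 (does (k ≟ toℕ a))) agree ⟩
  ∑[ k < n ] 𝟙 (does (k ≟ toℕ a))          ≡⟨ ∑<-single n _ (toℕ<n a) (λ k _ k≢a → cong 𝟙 (dec-false (k ≟ toℕ a) k≢a)) ⟩
  𝟙 (does (toℕ a ≟ toℕ a))                 ≡⟨ cong 𝟙 (dec-true (toℕ a ≟ toℕ a) refl) ⟩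
  1                                        ∎
  where
  open ≡-Reasoning
  agree : ∀ x → 𝟙 (does (x Fin.≟ a)) ≡ 𝟙 (does (toℕ x ≟ toℕ a))
  agree x with x Fin.≟ a
  ... | yes refl = cong 𝟙 (sym (dec-true (toℕ x ≟ toℕ x) refl))
  ... | no x≢a   = cong 𝟙 (sym (dec-false (toℕ x ≟ toℕ a) (x≢a ∘ toℕ-injective)))

allVecs-enumerates : ∀ {_≟_ : DecidableEquality A} {xs} → Enumerates _≟_ xs →
                     ∀ k → Enumerates (≡-dec _≟_) (allVecs xs k)
allVecs-enumerates enum zero    Vec.[]       = refl
allVecs-enumerates {_≟_ = _≟_} {xs} enum (suc k) (a Vec.∷ v) = begin
  ∑[ w ∈ allVecs xs (suc k) ] 𝟙 (does (w ≟ᵥ (a Vec.∷ v)))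
    ≡⟨ ∑-concatMap _ (λ x → map (x Vec.∷_) (allVecs xs k)) xs ⟩
  ∑[ x ∈ xs ] ∑[ w ∈ map (x Vec.∷_) (allVecs xs k) ] 𝟙 (does (w ≟ᵥ (a Vec.∷ v)))
    ≡⟨ ∑-cong xs (λ x → ∑-map _ (x Vec.∷_) (allVecs xs k)) ⟩
  ∑[ x ∈ xs ] ∑[ w ∈ allVecs xs k ] 𝟙 (does (x ≟ a) ∧ does (w ≟ᵥ v))
    ≡⟨ ∑-cong xs (λ x → trans (∑-cong (allVecs xs k) (λ w → 𝟙-∧ (does (x ≟ a)) _))
                              (sym (*-distribˡ-∑ (𝟙 (does (x ≟ a))) _ (allVecs xs k)))) ⟩
  ∑[ x ∈ xs ] (𝟙 (does (x ≟ a)) * multiplicity (≡-dec _≟_) v (allVecs xs k))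
    ≡⟨ ∑-cong xs (λ x → trans (cong (𝟙 (does (x ≟ a)) *_) (allVecs-enumerates enum k v)) (*-identityʳ _)) ⟩
  multiplicity _≟_ a xs
    ≡⟨ enum a ⟩
  1 ∎
  where
  open ≡-Reasoning
  _≟ᵥ_ = λ {m} → ≡-dec {n = m} _≟_

allEntries : ∀ {k} → (ℕ → A → Bool) → Vec A k → Bool
allEntries P Vec.[]       = true
allEntries P (x Vec.∷ w) = P 0 x ∧ allEntries (P ∘ suc) w

allEntries⁻ : ∀ {k} (P : ℕ → A → Bool) (w : Vec A k) → T (allEntries P w) → ∀ i → T (P (toℕ i) (lookup w i))
allEntries⁻ P (x Vec.∷ w) ok Fin.zero    = proj₁ (T-∧⁻ ok)
allEntries⁻ P (x Vec.∷ w) ok (Fin.suc i) = allEntries⁻ (P ∘ suc) w (proj₂ (T-∧⁻ ok)) i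

allEntries⁺ : ∀ {k} (P : ℕ → A → Bool) (w : Vec A k) → (∀ i → T (P (toℕ i) (lookup w i))) → T (allEntries P w)
allEntries⁺ P Vec.[]       ok = _
allEntries⁺ P (x Vec.∷ w) ok = T-∧⁺ (ok Fin.zero) (allEntries⁺ (P ∘ suc) w (ok ∘ Fin.suc))

∑-allVecs-allEntries : ∀ (xs : List A) k (P : ℕ → A → Bool) →
                       ∑[ w ∈ allVecs xs k ] 𝟙 (allEntries P w) ≡ ∏[ i < k ] ∑[ x ∈ xs ] 𝟙 (P i x)
∑-allVecs-allEntries xs zero    P = refl
∑-allVecs-allEntries xs (suc k) P = begin
  ∑[ w ∈ allVecs xs (suc k) ] 𝟙 (allEntries P w)
    ≡⟨ ∑-concatMap _ (λ x → map (x Vec.∷_) (allVecs xs k)) xs ⟩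
  ∑[ x ∈ xs ] ∑[ w ∈ map (x Vec.∷_) (allVecs xs k) ] 𝟙 (allEntries P w)
    ≡⟨ ∑-cong xs (λ x → ∑-map _ (x Vec.∷_) (allVecs xs k)) ⟩
  ∑[ x ∈ xs ] ∑[ w ∈ allVecs xs k ] 𝟙 (P 0 x ∧ allEntries (P ∘ suc) w)
    ≡⟨ ∑-cong xs (λ x → trans (∑-cong (allVecs xs k) (λ w → 𝟙-∧ (P 0 x) _))
                              (sym (*-distribˡ-∑ (𝟙 (P 0 x)) _ (allVecs xs k)))) ⟩
  ∑[ x ∈ xs ] (𝟙 (P 0 x) * ∑[ w ∈ allVecs xs k ] 𝟙 (allEntries (P ∘ suc) w))
    ≡⟨ sym (*-distribʳ-∑ _ (λ x → 𝟙 (P 0 x)) xs) ⟩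
  ∑[ x ∈ xs ] 𝟙 (P 0 x) * ∑[ w ∈ allVecs xs k ] 𝟙 (allEntries (P ∘ suc) w)
    ≡⟨ cong (∑[ x ∈ xs ] 𝟙 (P 0 x) *_) (∑-allVecs-allEntries xs k (P ∘ suc)) ⟩
  ∑[ x ∈ xs ] 𝟙 (P 0 x) * ∏[ i < k ] ∑[ x ∈ xs ] 𝟙 (P (suc i) x)
    ≡⟨ sym (∏<-front k (λ i → ∑[ x ∈ xs ] 𝟙 (P i x))) ⟩
  ∏[ i < suc k ] ∑[ x ∈ xs ] 𝟙 (P i x) ∎
  where open ≡-Reasoning

-- Rooted forests with a single non-record

allowedParent : ∀ {n} → ℕ → ℕ → ℕ → Maybe (Fin n) → Bool
allowedParent v u k q with k ≟ v | u <? k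
... | yes _ | _     = maybe (λ j → toℕ j ≡ᵇ u) false q
... | no _  | yes _ = maybe (λ j → toℕ j <ᵇ k) true q
... | no _  | no _  = maybe (λ j → (toℕ j <ᵇ k) ∧ not (toℕ j ≡ᵇ v)) true q

almostIncreasing : ∀ {n} → ℕ → ℕ → ParentMap n → Bool
almostIncreasing v u = allEntries (allowedParent v u)

module Walk {n} (p : ParentMap n) where

  reaches-parent : ∀ f {k j} → lookup p k ≡ just j → T (reaches p (suc f) k) → T (reaches p f j)
  reaches-parent f eq r rewrite eq = r

  ¬reaches-loop : ∀ f {k} → lookup p k ≡ just k → ¬ T (reaches p f k)
  ¬reaches-loop (suc f) eq r = ¬reaches-loop f eq (reaches-parent f eq r)

  ¬reaches-2-cycle : ∀ f {k j} → lookup p k ≡ just j → lookup p j ≡ just k → ¬ T (reaches p f k)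
  ¬reaches-2-cycle (suc zero)    eq eq′ r = reaches-parent 0 eq r
  ¬reaches-2-cycle (suc (suc f)) eq eq′ r = ¬reaches-2-cycle f eq eq′ (reaches-parent f eq′ (reaches-parent (suc f) eq r))

  reaches-by-rank : (rank : Fin n → ℕ) → (∀ {k j} → lookup p k ≡ just j → rank j < rank k) →
                    ∀ f k → rank k < f → T (reaches p f k)
  reaches-by-rank rank decreasing (suc f) k rk<1+f with lookup p k in eq
  ... | nothing = _
  ... | just j  = reaches-by-rank rank decreasing f j (<-≤-trans (decreasing eq) (s≤s⁻¹ rk<1+f))

  head∈path : ∀ f {k} → T (reaches p f k) → k ∈ path p f k
  head∈path (suc f) r = here refl

  parent∈path : ∀ f {k j} → lookup p k ≡ just j → T (reaches p f k) → j ∈ path p f k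
  parent∈path (suc f) eq r rewrite eq = there (head∈path f r)

  grandparent∈path : ∀ f {k j w} → lookup p k ≡ just j → lookup p j ≡ just w → T (reaches p f k) → w ∈ path p f k
  grandparent∈path (suc f) eq eq′ r rewrite eq = there (parent∈path f eq′ r)

  All-path-shorter : ∀ {P : Fin n → Set} f {k} → All P (path p (suc f) k) → All P (path p f k)
  All-path-shorter zero    _ = []
  All-path-shorter (suc f) {k} (pk ∷ a) with lookup p k
  ... | nothing = pk ∷ []
  ... | just j  = pk ∷ All-path-shorter f a

  All-path-via-parent : ∀ {P : Fin n → Set} f {k j} → lookup p k ≡ just j → P k → All P (path p f j) → All P (path p (suc f) k)
  All-path-via-parent f eq pk a rewrite eq = pk ∷ a

  forest⇒reaches : T (isForest p) → ∀ k → T (reaches p n k)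
  forest⇒reaches forest = tabulate⁻ (all⁺ _ _ forest)

  isRecord⁻ : ∀ {k} → T (isRecord p k) → All (λ w → toℕ w ≤ toℕ k) (path p n k)
  isRecord⁻ r = All.map (≤ᵇ⇒≤ _ _) (all⁺ _ _ r)

  isRecord⁺ : ∀ {k} → All (λ w → toℕ w ≤ toℕ k) (path p n k) → T (isRecord p k)
  isRecord⁺ a = all⁻ _ (All.map ≤⇒≤ᵇ a)

  root-isRecord : ∀ {k} → lookup p k ≡ nothing → T (isRecord p k)
  root-isRecord {k} eq = isRecord⁺ (root-path n)
    where
    root-path : ∀ f → All (λ w → toℕ w ≤ toℕ k) (path p f k)
    root-path zero    = []
    root-path (suc f) rewrite eq = ≤-refl ∷ []

-- The position of label k in the order 0, …, v−1, v+1, …, u, v, u+1, …, which puts every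
-- parent of an almost increasing forest before its child.
rank : ℕ → ℕ → ℕ → ℕ
rank v u k with k ≟ v | k <? v | k ≤? u
... | yes _ | _     | _     = u
... | no _  | yes _ | _     = k
... | no _  | no _  | yes _ = pred k
... | no _  | no _  | no _  = k

module Rank {v u : ℕ} (v<u : v < u) where

  rank-at : rank v u v ≡ u
  rank-at with v ≟ v
  ... | yes _   = refl
  ... | no v≢v = ⊥-elim (v≢v refl)

  rank-below : ∀ {k} → k < v → rank v u k ≡ k
  rank-below {k} k<v with k ≟ v | k <? v
  ... | yes k≡v | _      = ⊥-elim (<-irrefl k≡v k<v)
  ... | no _    | yes _  = refl
  ... | no _    | no k≮v = ⊥-elim (k≮v k<v)

  rank-between : ∀ {k} → v < k → k ≤ u → rank v u k ≡ pred k
  rank-between {k} v<k k≤u with k ≟ v | k <? v | k ≤? u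
  ... | yes k≡v | _       | _      = ⊥-elim (<-irrefl (sym k≡v) v<k)
  ... | no _    | yes k<v | _      = ⊥-elim (<-asym k<v v<k)
  ... | no _    | no _    | yes _  = refl
  ... | no _    | no _    | no k≰u = ⊥-elim (k≰u k≤u)

  rank-above : ∀ {k} → u < k → rank v u k ≡ k
  rank-above {k} u<k with k ≟ v | k <? v | k ≤? u
  ... | yes k≡v | _     | _       = ⊥-elim (<-asym v<u (subst (u <_) k≡v u<k))
  ... | no _    | yes _ | _       = refl
  ... | no _    | no _  | yes k≤u = ⊥-elim (<⇒≱ u<k k≤u)
  ... | no _    | no _  | no _    = refl

  rank-≤ : ∀ {k} → k ≢ v → rank v u k ≤ k
  rank-≤ {k} k≢v with k ≟ v | k <? v | k ≤? u
  ... | yes k≡v | _     | _     = ⊥-elim (k≢v k≡v)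
  ... | no _    | yes _ | _     = ≤-refl
  ... | no _    | no _  | yes _ = pred[n]≤n
  ... | no _    | no _  | no _  = ≤-refl

  rank-monotone : ∀ {j k} → j < k → j ≢ v → k ≢ v → rank v u j < rank v u k
  rank-monotone {j} {k} j<k j≢v k≢v with <-cmp k v | u <? k
  ... | tri≈ _ k≡v _ | _        = ⊥-elim (k≢v k≡v)
  ... | tri< k<v _ _ | _        = subst₂ _<_ (sym (rank-below (<-trans j<k k<v))) (sym (rank-below k<v)) j<k
  ... | tri> _ _ v<k | yes u<k  = subst (rank v u j <_) (sym (rank-above u<k)) (≤-<-trans (rank-≤ j≢v) j<k)
  ... | tri> _ _ v<k | no u≮k with <-cmp j v
  ...   | tri≈ _ j≡v _ = ⊥-elim (j≢v j≡v)
  ...   | tri< j<v _ _ = subst₂ _<_ (sym (rank-below j<v)) (sym (rank-between v<k k≤u)) (<-≤-trans j<v (pred-mono-≤ v<k))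
    where k≤u = ≮⇒≥ u≮k
  ...   | tri> _ _ v<j = subst₂ _<_ (sym (rank-between v<j (<⇒≤ (<-≤-trans j<k k≤u)))) (sym (rank-between v<k k≤u))
                                   (pred-mono-< ⦃ >-nonZero (≤-<-trans z≤n v<j) ⦄ j<k)
    where k≤u = ≮⇒≥ u≮k

almostIncreasing⁺ : ∀ {n} {v u : ℕ} (p : ParentMap n) →
  (∀ k → toℕ k ≡ v → Σ (Fin n) λ j → lookup p k ≡ just j × toℕ j ≡ u) →
  (∀ k j → toℕ k ≢ v → lookup p k ≡ just j → toℕ j < toℕ k × (toℕ j ≡ v → u < toℕ k)) →
  T (almostIncreasing v u p)
almostIncreasing⁺ {v = v} {u} p exceptional ordinary = allEntries⁺ (allowedParent v u) p allowed
  where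
  allowed : ∀ k → T (allowedParent v u (toℕ k) (lookup p k))
  allowed k with toℕ k ≟ v | u <? toℕ k | lookup p k in eq
  ... | yes k≡v | _     | q with exceptional k k≡v
  ...   | j , eq′ , j≡u rewrite eq′ with refl ← eq = ≡⇒≡ᵇ _ _ j≡u
  allowed k | no _ | yes _ | nothing = _
  allowed k | no _ | no _  | nothing = _
  allowed k | no k≢v | yes _ | just j = <⇒<ᵇ (proj₁ (ordinary k j k≢v eq))
  allowed k | no k≢v | no u≮k | just j = T-∧⁺ (<⇒<ᵇ j<k) (T-not⁺ (λ j≡v → u≮k (below-v (≡ᵇ⇒≡ _ _ j≡v))))
    where
    j<k = proj₁ (ordinary k j k≢v eq)
    below-v = proj₂ (ordinary k j k≢v eq)

module AlmostIncreasing {n : ℕ} {v u : ℕ} (p : ParentMap n) (ai : T (almostIncreasing v u p)) where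

  allowed-at : ∀ k → T (allowedParent v u (toℕ k) (lookup p k))
  allowed-at = allEntries⁻ (allowedParent v u) p ai

  exceptional-edge : ∀ {k} → toℕ k ≡ v → Σ (Fin n) λ j → lookup p k ≡ just j × toℕ j ≡ u
  exceptional-edge {k} k≡v with toℕ k ≟ v | lookup p k | allowed-at k
  ... | no k≢v | _      | _  = ⊥-elim (k≢v k≡v)
  ... | yes _  | just j | ok = j , refl , ≡ᵇ⇒≡ _ _ ok

  ordinary-edge : ∀ {k j} → toℕ k ≢ v → lookup p k ≡ just j → toℕ j < toℕ k × (toℕ j ≡ v → u < toℕ k)
  ordinary-edge {k} {j} k≢v eq with allowed-at k
  ... | ok rewrite eq with toℕ k ≟ v | u <? toℕ k
  ... | yes k≡v | _     = ⊥-elim (k≢v k≡v)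
  ... | no _    | yes u<k = <ᵇ⇒< _ _ ok , λ _ → u<k
  ... | no _    | no _    = <ᵇ⇒< _ _ (proj₁ both) , λ j≡v → ⊥-elim (T-not⁻ (proj₂ both) (≡⇒≡ᵇ _ _ j≡v))
    where both = T-∧⁻ ok

  module _ (v<u : v < u) (u<n : u < n) where
    open Rank v<u
    open Walk p

    rank-decreasing : ∀ {k j} → lookup p k ≡ just j → rank v u (toℕ j) < rank v u (toℕ k)
    -- A with on toℕ k ≟ v would also rewrite the tests inside rank, hence the case split on arguments.
    rank-decreasing {k} {j} eq = by-cases (toℕ k ≟ v) (toℕ j ≟ v)
      where
      by-cases : Dec (toℕ k ≡ v) → Dec (toℕ j ≡ v) → rank v u (toℕ j) < rank v u (toℕ k)
      by-cases (yes k≡v) _ with exceptional-edge k≡v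
      ... | j′ , eq′ , j′≡u with refl ← trans (sym eq) eq′ rewrite j′≡u | k≡v | rank-between v<u ≤-refl | rank-at =
            ≤-reflexive (suc-pred u ⦃ >-nonZero (≤-<-trans z≤n v<u) ⦄)
      by-cases (no k≢v) (no j≢v)  = rank-monotone (proj₁ (ordinary-edge k≢v eq)) j≢v k≢v
      by-cases (no k≢v) (yes j≡v) with proj₂ (ordinary-edge k≢v eq) j≡v
      ... | u<k rewrite j≡v | rank-at | rank-above u<k = u<k

    rank<n : ∀ k → rank v u (toℕ k) < n
    rank<n k = by-cases (toℕ k ≟ v)
      where
      by-cases : Dec (toℕ k ≡ v) → rank v u (toℕ k) < n
      by-cases (yes k≡v) rewrite k≡v | rank-at = u<n
      by-cases (no k≢v)  = ≤-<-trans (rank-≤ k≢v) (toℕ<n k)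

    forest : T (isForest p)
    forest = all⁻ _ (tabulate⁺ λ k → reaches-by-rank (rank v u ∘ toℕ) rank-decreasing n k (rank<n k))

    path-bounded : ∀ f k {b} → toℕ k ≤ b → (toℕ k ≡ v → u ≤ b) → All (λ w → toℕ w ≤ b) (path p f k)
    path-bounded zero    k k≤b _      = []
    path-bounded (suc f) k {b} k≤b v⇒u≤b with lookup p k in eq | toℕ k ≟ v
    ... | nothing | _ = k≤b ∷ []
    ... | just j | yes k≡v with exceptional-edge k≡v
    ...   | j′ , eq′ , j′≡u with refl ← trans (sym eq) eq′ =
            k≤b ∷ path-bounded f j (subst (_≤ b) (sym j′≡u) (v⇒u≤b k≡v)) (λ _ → v⇒u≤b k≡v)
    path-bounded (suc f) k {b} k≤b v⇒u≤b | just j | no k≢v =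
      k≤b ∷ path-bounded f j (<⇒≤ (<-≤-trans j<k k≤b)) (λ j≡v → <⇒≤ (<-≤-trans (hangs-on-v j≡v) k≤b))
      where
      j<k = proj₁ (ordinary-edge k≢v eq)
      hangs-on-v = proj₂ (ordinary-edge k≢v eq)

    isRecord-≢v : ∀ {k} → toℕ k ≢ v → T (isRecord p k)
    isRecord-≢v k≢v = isRecord⁺ (path-bounded n _ ≤-refl (⊥-elim ∘ k≢v))

    ¬isRecord-v : ∀ {k} → toℕ k ≡ v → ¬ T (isRecord p k)
    ¬isRecord-v k≡v r with exceptional-edge k≡v
    ... | j , eq , j≡u = <⇒≱ v<u (subst₂ _≤_ j≡u k≡v
                           (All.lookup (isRecord⁻ r) (parent∈path n eq (forest⇒reaches forest _))))

    numRecords≡n-1 : numRecords p ≡ n ∸ 1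
    numRecords≡n-1 = begin
      numRecords p                             ≡⟨ count≡∑𝟙 (isRecord p) (allFin n) ⟩
      ∑[ k ∈ allFin n ] 𝟙 (isRecord p k)       ≡⟨ ∑-cong (allFin n) isRecord≡≢v ⟩
      others                                   ≡⟨ m+n∸m≡n 1 others ⟨
      1 + others ∸ 1                           ≡⟨ cong (λ m → m + others ∸ 1) one-v ⟨
      ∑[ k ∈ allFin n ] 𝟙 (toℕ k ≡ᵇ v) + others ∸ 1  ≡⟨ cong (_∸ 1) (∑-allFin-complement n (λ k → toℕ k ≡ᵇ v)) ⟩
      n ∸ 1                                    ∎
      where
      open ≡-Reasoning
      others = ∑[ k ∈ allFin n ] 𝟙 (not (toℕ k ≡ᵇ v))
      isRecord≡≢v : ∀ k → 𝟙 (isRecord p k) ≡ 𝟙 (not (toℕ k ≡ᵇ v))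
      isRecord≡≢v k with toℕ k ≟ v
      ... | yes k≡v = trans (𝟙-¬T (¬isRecord-v k≡v)) (sym (𝟙-¬T (λ t → T-not⁻ t (≡⇒≡ᵇ _ _ k≡v))))
      ... | no k≢v  = trans (𝟙-T (isRecord-≢v k≢v)) (sym (𝟙-T (T-not⁺ (k≢v ∘ ≡ᵇ⇒≡ _ _))))
      one-v : ∑[ k ∈ allFin n ] 𝟙 (toℕ k ≡ᵇ v) ≡ 1
      one-v = trans (∑-allFin n (λ k → 𝟙 (k ≡ᵇ v))) (∑<-𝟙-≡ n (<-trans v<u u<n))

module OneNonRecord {m : ℕ} (p : ParentMap (suc m)) (forest : T (isForest p)) (m-records : numRecords p ≡ m) where
  open Walk p

  reach : ∀ k → T (reaches p (suc m) k)
  reach = forest⇒reaches forest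

  one-non-record : ∑[ k ∈ allFin (suc m) ] 𝟙 (not (isRecord p k)) ≡ 1
  one-non-record = +-cancelˡ-≡ m _ 1 (begin
    m + others                                             ≡⟨ cong (_+ others) (trans (sym m-records) (count≡∑𝟙 (isRecord p) (allFin (suc m)))) ⟩
    ∑[ k ∈ allFin (suc m) ] 𝟙 (isRecord p k) + others      ≡⟨ ∑-allFin-complement (suc m) (isRecord p) ⟩
    suc m                                                  ≡⟨ +-comm 1 m ⟩
    m + 1                                                  ∎)
    where
    open ≡-Reasoning
    others = ∑[ k ∈ allFin (suc m) ] 𝟙 (not (isRecord p k))

  non-record = ∑-𝟙≡1⇒unique (not ∘ isRecord p) id one-non-record

  v̂ : Fin (suc m)
  v̂ = proj₁ non-record

  ¬isRecord-v̂ : ¬ T (isRecord p v̂)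
  ¬isRecord-v̂ = T-not⁻ (proj₁ (proj₂ non-record))

  isRecord-≢v̂ : ∀ k → k ≢ v̂ → T (isRecord p k)
  isRecord-≢v̂ k k≢v̂ with isRecord p k in eq
  ... | true  = _
  ... | false = ⊥-elim (k≢v̂ (proj₂ (proj₂ non-record) k (subst (T ∘ not) (sym eq) _)))

  no-loop : ∀ {k j} → lookup p k ≡ just j → j ≢ k
  no-loop {k} eq refl = ¬reaches-loop (suc m) eq (reach k)

  parent<-≢v̂ : ∀ {k j} → k ≢ v̂ → lookup p k ≡ just j → toℕ j < toℕ k
  parent<-≢v̂ {k} k≢v̂ eq = ≤∧≢⇒< (All.lookup (isRecord⁻ (isRecord-≢v̂ k k≢v̂)) (parent∈path (suc m) eq (reach k)))
                                 (no-loop eq ∘ toℕ-injective)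

  parent-of-v̂ : Σ (Fin (suc m)) λ û → lookup p v̂ ≡ just û
  parent-of-v̂ with lookup p v̂ in eq
  ... | nothing = ⊥-elim (¬isRecord-v̂ (root-isRecord eq))
  ... | just û  = û , refl

  û : Fin (suc m)
  û = proj₁ parent-of-v̂

  v̂→û : lookup p v̂ ≡ just û
  v̂→û = proj₂ parent-of-v̂

  v̂<û : toℕ v̂ < toℕ û
  v̂<û with toℕ v̂ <? toℕ û
  ... | yes v̂<û = v̂<û
  ... | no v̂≮û = ⊥-elim (¬isRecord-v̂ (isRecord⁺ (All-path-via-parent m v̂→û ≤-refl
          (All.map (λ w≤û → ≤-trans w≤û (≮⇒≥ v̂≮û))
                   (All-path-shorter m (isRecord⁻ (isRecord-≢v̂ û (no-loop v̂→û))))))))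

  child-of-v̂ : ∀ {k} → k ≢ v̂ → lookup p k ≡ just v̂ → toℕ û < toℕ k
  child-of-v̂ {k} k≢v̂ eq = ≤∧≢⇒< (All.lookup (isRecord⁻ (isRecord-≢v̂ k k≢v̂)) (grandparent∈path (suc m) eq v̂→û (reach k)))
                                (λ û≡k → ¬reaches-2-cycle (suc m) eq (trans v̂→û (cong just (toℕ-injective û≡k))) (reach k))

  almostIncreasing-v̂û : T (almostIncreasing (toℕ v̂) (toℕ û) p)
  almostIncreasing-v̂û = almostIncreasing⁺ p exceptional ordinary
    where
    exceptional : ∀ k → toℕ k ≡ toℕ v̂ → Σ (Fin (suc m)) λ j → lookup p k ≡ just j × toℕ j ≡ toℕ û
    exceptional k k≡v̂ with refl ← toℕ-injective k≡v̂ = û , v̂→û , refl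
    ordinary : ∀ k j → toℕ k ≢ toℕ v̂ → lookup p k ≡ just j → toℕ j < toℕ k × (toℕ j ≡ toℕ v̂ → toℕ û < toℕ k)
    ordinary k j k≢v̂ eq = parent<-≢v̂ (k≢v̂ ∘ cong toℕ) eq ,
                          λ j≡v̂ → child-of-v̂ (k≢v̂ ∘ cong toℕ) (subst (λ i → lookup p k ≡ just i) (toℕ-injective j≡v̂) eq)

allowedCount : ℕ → ℕ → ℕ → ℕ
allowedCount v u k with k ≟ v | u <? k
... | yes _ | _     = 1
... | no _  | yes _ = suc k
... | no _  | no _  = suc (k ∸ 𝟙 (v <ᵇ k))

∑-allowedParent : ∀ n {v u k} → v < n → u < n → k < n →
                  ∑[ q ∈ nothing ∷ map just (allFin n) ] 𝟙 (allowedParent v u k q) ≡ allowedCount v u k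
∑-allowedParent n {v} {u} {k} v<n u<n k<n with k ≟ v | u <? k
... | yes _ | _     = trans (∑-map _ just (allFin n)) (trans (∑-allFin n (λ j → 𝟙 (j ≡ᵇ u))) (∑<-𝟙-≡ n u<n))
... | no _  | yes _ = cong suc (trans (∑-map _ just (allFin n)) (trans (∑-allFin n (λ j → 𝟙 (j <ᵇ k)))
                                  (trans (∑<-𝟙-< n k) (m≥n⇒m⊓n≡n (<⇒≤ k<n)))))
... | no _  | no u≮k = cong suc (trans (∑-map _ just (allFin n)) (trans (∑-allFin n (λ j → 𝟙 ((j <ᵇ k) ∧ not (j ≡ᵇ v))))
                                  (∑<-𝟙-<-≢ n (<⇒≤ k<n) v<n)))

module AllowedCount {v u : ℕ} (v<u : v < u) where

  allowedCount-at : allowedCount v u v ≡ 1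
  allowedCount-at with v ≟ v
  ... | yes _  = refl
  ... | no v≢v = ⊥-elim (v≢v refl)

  allowedCount-below : ∀ {k} → k < v → allowedCount v u k ≡ suc k
  allowedCount-below {k} k<v with k ≟ v | u <? k
  ... | yes k≡v | _       = ⊥-elim (<-irrefl k≡v k<v)
  ... | no _    | yes u<k = ⊥-elim (<-asym k<v (<-trans v<u u<k))
  ... | no _    | no _    rewrite 𝟙-¬T (<-asym k<v ∘ <ᵇ⇒< v k) = refl

  allowedCount-between : ∀ {k} → v < k → k ≤ u → allowedCount v u k ≡ k
  allowedCount-between {k} v<k k≤u with k ≟ v | u <? k
  ... | yes k≡v | _       = ⊥-elim (<-irrefl (sym k≡v) v<k)
  ... | no _    | yes u<k = ⊥-elim (<⇒≱ u<k k≤u)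
  ... | no _    | no _    rewrite 𝟙-T (<⇒<ᵇ v<k) = suc-pred k ⦃ >-nonZero (≤-<-trans z≤n v<k) ⦄

  allowedCount-above : ∀ {k} → u < k → allowedCount v u k ≡ suc k
  allowedCount-above {k} u<k with k ≟ v | u <? k
  ... | yes k≡v | _      = ⊥-elim (<-asym v<u (subst (u <_) k≡v u<k))
  ... | no _    | yes _  = refl
  ... | no _    | no u≮k = ⊥-elim (u≮k u<k)

  -- On the positions v, …, u, allowedCount v u lists the factors 1, v+1, …, u while omitFactor u
  -- lists v+1, …, u, 1; scale k is the factor in transit.
  scale : ℕ → ℕ
  scale k with v <? k | k ≤? u
  ... | yes _ | yes _ = k
  ... | _     | _     = 1

  scale-≤v : ∀ {k} → k ≤ v → scale k ≡ 1
  scale-≤v {k} k≤v with v <? k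
  ... | yes v<k = ⊥-elim (<⇒≱ v<k k≤v)
  ... | no _    = refl

  scale-between : ∀ {k} → v < k → k ≤ u → scale k ≡ k
  scale-between {k} v<k k≤u with v <? k | k ≤? u
  ... | yes _  | yes _  = refl
  ... | no v≮k | _      = ⊥-elim (v≮k v<k)
  ... | yes _  | no k≰u = ⊥-elim (k≰u k≤u)

  scale-above : ∀ {k} → u < k → scale k ≡ 1
  scale-above {k} u<k with v <? k | k ≤? u
  ... | yes _ | yes k≤u = ⊥-elim (<⇒≱ u<k k≤u)
  ... | yes _ | no _    = refl
  ... | no _  | _       = refl

  allowedCount-telescopes : ∀ k → allowedCount v u k * scale (suc k) ≡ scale k * omitFactor u k
  allowedCount-telescopes k with <-cmp k v
  ... | tri< k<v _ _ rewrite allowedCount-below k<v | scale-≤v k<v | scale-≤v (<⇒≤ k<v)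
                           | omitFactor-≢ (<⇒≢ (<-trans k<v v<u)) = *-comm (suc k) 1
  ... | tri≈ _ refl _ rewrite allowedCount-at | scale-between (n<1+n v) v<u | scale-≤v (≤-refl {v})
                            | omitFactor-≢ (<⇒≢ v<u) = refl
  ... | tri> _ _ v<k with <-cmp k u
  ...   | tri< k<u _ _ rewrite allowedCount-between v<k (<⇒≤ k<u) | scale-between (m<n⇒m<1+n v<k) k<u
                             | scale-between v<k (<⇒≤ k<u) | omitFactor-≢ (<⇒≢ k<u) = refl
  ...   | tri≈ _ refl _ rewrite allowedCount-between v<u ≤-refl | scale-above (n<1+n u) | scale-between v<u ≤-refl
                              | omitFactor-at u = refl
  ...   | tri> _ _ u<k rewrite allowedCount-above u<k | scale-above (m<n⇒m<1+n u<k) | scale-above u<k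
                           | omitFactor-≢ (>⇒≢ u<k) = *-comm (suc k) 1

  ∏-allowedCount : ∀ {n} → u < n → ∏[ k < n ] allowedCount v u k ≡ factorialOmitting n u
  ∏-allowedCount {n} u<n = begin
    ∏[ k < n ] allowedCount v u k             ≡⟨ *-identityʳ _ ⟨
    ∏[ k < n ] allowedCount v u k * 1         ≡⟨ cong (∏[ k < n ] allowedCount v u k *_) (scale-above u<n) ⟨
    ∏[ k < n ] allowedCount v u k * scale n   ≡⟨ ∏<-telescope n (allowedCount v u) (omitFactor u) scale
                                                                  (λ k _ → allowedCount-telescopes k) ⟩
    scale 0 * factorialOmitting n u           ≡⟨ cong (_* factorialOmitting n u) (scale-≤v z≤n) ⟩
    1 * factorialOmitting n u                 ≡⟨ *-identityˡ _ ⟩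
    factorialOmitting n u                     ∎
    where open ≡-Reasoning

count-almostIncreasing : ∀ {n v u} → v < u → u < n →
                         ∑[ p ∈ allParentMaps n ] 𝟙 (almostIncreasing v u p) ≡ factorialOmitting n u
count-almostIncreasing {n} {v} {u} v<u u<n = begin
  ∑[ p ∈ allParentMaps n ] 𝟙 (almostIncreasing v u p)
    ≡⟨ ∑-allVecs-allEntries (nothing ∷ map just (allFin n)) n (allowedParent v u) ⟩
  ∏[ k < n ] ∑[ q ∈ nothing ∷ map just (allFin n) ] 𝟙 (allowedParent v u k q)
    ≡⟨ ∏<-cong n (λ k k<n → ∑-allowedParent n (<-trans v<u u<n) u<n k<n) ⟩
  ∏[ k < n ] allowedCount v u k
    ≡⟨ AllowedCount.∏-allowedCount v<u u<n ⟩
  factorialOmitting n u ∎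
  where open ≡-Reasoning

almostIncreasing-unique : ∀ {n v u v′ u′} (p : ParentMap n) → v′ < u′ → u′ < n →
                          T (almostIncreasing v u p) → T (almostIncreasing v′ u′ p) → v ≡ v′ × u ≡ u′
almostIncreasing-unique {n} {v} {u} {v′} {u′} p v′<u′ u′<n ai ai′ = v≡v′ , u≡u′
  where
  module AI  = AlmostIncreasing p ai
  module AI′ = AlmostIncreasing p ai′
  k : Fin n
  k = Fin.fromℕ< (<-trans v′<u′ u′<n)
  k≡v′ : toℕ k ≡ v′
  k≡v′ = toℕ-fromℕ< (<-trans v′<u′ u′<n)
  j′ = proj₁ (AI′.exceptional-edge k≡v′)
  k→j′ = proj₁ (proj₂ (AI′.exceptional-edge k≡v′))
  j′≡u′ = proj₂ (proj₂ (AI′.exceptional-edge k≡v′))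
  v≡v′ : v ≡ v′
  v≡v′ with v ≟ v′
  ... | yes v≡v′ = v≡v′
  ... | no v≢v′  = ⊥-elim (<-asym v′<u′ (subst₂ _<_ j′≡u′ k≡v′
                     (proj₁ (AI.ordinary-edge (λ k≡v → v≢v′ (trans (sym k≡v) k≡v′)) k→j′))))
  u≡u′ : u ≡ u′
  u≡u′ with AI.exceptional-edge (trans k≡v′ (sym v≡v′))
  ... | j , k→j , j≡u = trans (sym j≡u) (trans (cong toℕ (just-injective (trans (sym k→j) k→j′))) j′≡u′)

𝟙-forest-with-m-records : ∀ {m} (p : ParentMap (suc m)) →
  𝟙 (isForest p ∧ (numRecords p ≡ᵇ m)) ≡ ∑[ u < suc m ] ∑[ v < u ] 𝟙 (almostIncreasing v u p)
𝟙-forest-with-m-records {m} p with isForest p ∧ (numRecords p ≡ᵇ m) in eq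
... | false = sym (∑<-vanish (suc m) λ u u<n → ∑<-vanish u λ v v<u → 𝟙-¬T λ ai →
                subst T eq (T-∧⁺ (forest p ai v<u u<n) (≡⇒≡ᵇ _ _ (numRecords≡n-1 p ai v<u u<n))))
  where open AlmostIncreasing
... | true  = sym (begin
  ∑[ u < suc m ] ∑[ v < u ] 𝟙 (almostIncreasing v u p)  ≡⟨ ∑<-single (suc m) _ û<n (λ u _ u≢û → ∑<-vanish u λ v v<u →
                                                             𝟙-¬T (u≢û ∘ proj₂ ∘ unique v<u)) ⟩
  ∑[ v < û ] 𝟙 (almostIncreasing v û p)               ≡⟨ ∑<-single û _ v̂<û (λ v v<û v≢v̂ →
                                                             𝟙-¬T (v≢v̂ ∘ proj₁ ∘ unique v<û)) ⟩
  𝟙 (almostIncreasing v̂ û p)                          ≡⟨ 𝟙-T ai ⟩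
  1                                                    ∎)
  where
  open ≡-Reasoning
  forest∧records = T-∧⁻ (subst T (sym eq) _)
  open OneNonRecord p (proj₁ forest∧records) (≡ᵇ⇒≡ _ _ (proj₂ forest∧records))
    renaming (v̂ to v̂-vertex; û to û-vertex)
  v̂ = toℕ v̂-vertex
  û = toℕ û-vertex
  ai = almostIncreasing-v̂û
  û<n = toℕ<n û-vertex
  unique : ∀ {v u} → v < u → T (almostIncreasing v u p) → v ≡ v̂ × u ≡ û
  unique v<u ai′ = almostIncreasing-unique p v̂<û û<n ai′ ai

R≡∑factorialReplacing : ∀ m → R (suc m) m ≡ ∑[ u < suc m ] factorialReplacing (suc m) u
R≡∑factorialReplacing m = begin
  R n m
    ≡⟨ count≡∑𝟙 _ (allParentMaps n) ⟩
  ∑[ p ∈ allParentMaps n ] 𝟙 (isForest p ∧ (numRecords p ≡ᵇ m))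
    ≡⟨ ∑-cong (allParentMaps n) 𝟙-forest-with-m-records ⟩
  ∑[ p ∈ allParentMaps n ] ∑[ u < n ] ∑[ v < u ] 𝟙 (almostIncreasing v u p)
    ≡⟨ ∑-∑<-comm n (λ u p → ∑[ v < u ] 𝟙 (almostIncreasing v u p)) (allParentMaps n) ⟩
  ∑[ u < n ] ∑[ p ∈ allParentMaps n ] ∑[ v < u ] 𝟙 (almostIncreasing v u p)
    ≡⟨ ∑<-cong n (λ u _ → ∑-∑<-comm u (λ v p → 𝟙 (almostIncreasing v u p)) (allParentMaps n)) ⟩
  ∑[ u < n ] ∑[ v < u ] ∑[ p ∈ allParentMaps n ] 𝟙 (almostIncreasing v u p)
    ≡⟨ ∑<-cong n (λ u u<n → ∑<-cong u (λ v v<u → count-almostIncreasing v<u u<n)) ⟩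
  ∑[ u < n ] ∑[ v < u ] factorialOmitting n u
    ≡⟨ ∑<-cong n (λ u u<n → trans (∑<-const u _) (sym (factorialReplacing≡ u<n))) ⟩
  ∑[ u < n ] factorialReplacing n u ∎
  where
  open ≡-Reasoning
  n = suc m

-- Permutations and cycle minima

¬all⇒∃¬ : ∀ {m} (p : Fin m → Bool) → ¬ T (all p (allFin m)) → Σ (Fin m) λ x → ¬ T (p x)
¬all⇒∃¬ {m} p ¬all = satisfied (¬All⇒Any¬ (T? ∘ p) (allFin m) (¬all ∘ all⁻ p))

module _ {n : ℕ} where

  IsInjective : Perm n → Set
  IsInjective σ = Injective _≡_ _≡_ (lookup σ)

  isPerm⁻ : ∀ (σ : Perm n) → T (isPerm σ) → IsInjective σ
  isPerm⁻ σ ok {x} {y} σx≡σy with toℕ x ≡ᵇ toℕ y in eq | tabulate⁻ (all⁺ _ _ (tabulate⁻ (all⁺ _ _ ok) x)) y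
  ... | true  | _     = toℕ-injective (≡ᵇ⇒≡ _ _ (subst T (sym eq) _))
  ... | false | σx≢σy = ⊥-elim (T-not⁻ σx≢σy (≡⇒≡ᵇ _ _ (cong toℕ σx≡σy)))

  isPerm⁺ : ∀ (σ : Perm n) → IsInjective σ → T (isPerm σ)
  -- Argued by contradiction: the disjunction used in isPerm is local to Defs and cannot be named.
  isPerm⁺ σ injective with T? (isPerm σ)
  ... | yes ok = ok
  ... | no ¬ok with ¬all⇒∃¬ {n} _ ¬ok
  ...   | x , ¬row with ¬all⇒∃¬ {n} _ ¬row
  ...     | y , ¬entry with toℕ x ≡ᵇ toℕ y in eq | ¬entry
  ...       | true  | ¬true    = ⊥-elim (¬true _)
  ...       | false | ¬σx≢σy   = ⊥-elim (¬σx≢σy (T-not⁺ λ σx≡σy →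
                                   subst T eq (≡⇒≡ᵇ _ _ (cong toℕ (injective (toℕ-injective (≡ᵇ⇒≡ _ _ σx≡σy)))))))

  iter-+ : ∀ (σ : Perm n) a b i → iter σ (a + b) i ≡ iter σ a (iter σ b i)
  iter-+ σ zero    b i = refl
  iter-+ σ (suc a) b i = cong (lookup σ) (iter-+ σ a b i)

  iter-suc : ∀ (σ : Perm n) m i → iter σ (suc m) i ≡ iter σ m (lookup σ i)
  iter-suc σ m i = trans (cong (λ a → iter σ a i) (+-comm 1 m)) (iter-+ σ m 1 i)

  iter-injective : ∀ (σ : Perm n) → IsInjective σ → ∀ m {i j} → iter σ m i ≡ iter σ m j → i ≡ j
  iter-injective σ injective zero    eq = eq
  iter-injective σ injective (suc m) eq = iter-injective σ injective m (injective eq)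

  iter-fixed : ∀ (σ : Perm n) {i} → lookup σ i ≡ i → ∀ m → iter σ m i ≡ i
  iter-fixed σ σi≡i zero    = refl
  iter-fixed σ σi≡i (suc m) = trans (cong (lookup σ) (iter-fixed σ σi≡i m)) σi≡i

  period : ∀ (σ : Perm n) → IsInjective σ → ∀ i → Σ ℕ λ p → 0 < p × p ≤ n × iter σ p i ≡ i
  period σ injective i with pigeonhole (n<1+n n) (λ a → iter σ (toℕ a) i)
  ... | a , b , a<b , eq = toℕ b ∸ toℕ a , m<n⇒0<n∸m a<b , ≤-trans (m∸n≤m (toℕ b) (toℕ a)) (s≤s⁻¹ (toℕ<n b)) ,
        iter-injective σ injective (toℕ a) (begin
          iter σ (toℕ a) (iter σ (toℕ b ∸ toℕ a) i)  ≡⟨ iter-+ σ (toℕ a) _ i ⟨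
          iter σ (toℕ a + (toℕ b ∸ toℕ a)) i        ≡⟨ cong (λ m → iter σ m i) (m+[n∸m]≡n (<⇒≤ a<b)) ⟩
          iter σ (toℕ b) i                          ≡⟨ eq ⟨
          iter σ (toℕ a) i                          ∎)
    where open ≡-Reasoning

  iter-mod : ∀ (σ : Perm n) {i p} → 0 < p → iter σ p i ≡ i → ∀ m → Σ ℕ λ r → r < p × iter σ m i ≡ iter σ r i
  iter-mod σ 0<p eq zero = 0 , 0<p , refl
  iter-mod σ {i} {p} 0<p eq (suc m) with iter-mod σ 0<p eq m
  ... | r , r<p , eq′ with suc r ≟ p
  ...   | yes 1+r≡p = 0 , 0<p , trans (cong (lookup σ) eq′) (trans (cong (λ a → iter σ a i) 1+r≡p) eq)
  ...   | no 1+r≢p  = suc r , ≤∧≢⇒< r<p 1+r≢p , cong (lookup σ) eq′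

  preimage : ∀ (σ : Perm n) → IsInjective σ → ∀ y → Σ (Fin n) λ x → lookup σ x ≡ y
  preimage σ injective y with period σ injective y
  ... | suc p , _ , _ , eq = iter σ p y , eq

  multiplicity-image : ∀ (σ : Perm n) → IsInjective σ → ∀ y → ∑[ x ∈ allFin n ] 𝟙 (does (lookup σ x Fin.≟ y)) ≡ 1
  multiplicity-image σ injective y with preimage σ injective y
  ... | x₀ , σx₀≡y = trans (∑-cong (allFin n) same) (allFin-enumerates n x₀)
    where
    same : ∀ x → 𝟙 (does (lookup σ x Fin.≟ y)) ≡ 𝟙 (does (x Fin.≟ x₀))
    same x with lookup σ x Fin.≟ y | x Fin.≟ x₀
    ... | yes _     | yes _     = refl
    ... | no _      | no _      = refl
    ... | yes σx≡y  | no x≢x₀   = ⊥-elim (x≢x₀ (injective (trans σx≡y (sym σx₀≡y))))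
    ... | no σx≢y   | yes x≡x₀  = ⊥-elim (σx≢y (trans (cong (lookup σ) x≡x₀) σx₀≡y))

  IsCycleMin : Perm n → Fin n → Set
  IsCycleMin σ i = ∀ m → toℕ i ≤ toℕ (iter σ m i)

  isCycleMin⁺ : ∀ (σ : Perm n) {i} → IsCycleMin σ i → T (isCycleMin σ i)
  isCycleMin⁺ σ min = all⁻ _ (applyUpTo⁺₁ suc n λ {j} _ → ≤⇒≤ᵇ (min (suc j)))

  isCycleMin⁻ : ∀ (σ : Perm n) {i} → IsInjective σ → T (isCycleMin σ i) → IsCycleMin σ i
  isCycleMin⁻ σ {i} injective ok m with period σ injective i
  ... | p , 0<p , p≤n , σᵖi≡i with iter-mod σ 0<p σᵖi≡i m
  ...   | zero  , _   , eq = subst (λ x → toℕ i ≤ toℕ x) (sym eq) ≤-refl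
  ...   | suc r , 1+r<p , eq = subst (λ x → toℕ i ≤ toℕ x) (sym eq)
                                 (≤ᵇ⇒≤ _ _ (All.lookup (all⁺ _ _ ok) (∈-applyUpTo⁺ suc (≤-trans (<⇒≤ 1+r<p) p≤n))))

transpose-matchˡ : ∀ {n} (a b : Fin n) → transpose a b a ≡ b
transpose-matchˡ a b rewrite dec-true (a Fin.≟ a) refl = refl

transpose-matchʳ : ∀ {n} (a b : Fin n) → transpose a b b ≡ a
transpose-matchʳ a b with b Fin.≟ a
... | yes refl = refl
... | no _ rewrite dec-true (b Fin.≟ b) refl = refl

transpose-other : ∀ {n} {a b x : Fin n} → x ≢ a → x ≢ b → transpose a b x ≡ x
transpose-other {a = a} {b} {x} x≢a x≢b rewrite dec-false (x Fin.≟ a) x≢a | dec-false (x Fin.≟ b) x≢b = refl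

module _ {n : ℕ} where

  _∘⟨_↔_⟩ : Perm n → Fin n → Fin n → Perm n
  σ ∘⟨ a ↔ b ⟩ = Vec.tabulate (lookup σ ∘ transpose a b)

  lookup-∘⟨↔⟩ : ∀ σ a b x → lookup (σ ∘⟨ a ↔ b ⟩) x ≡ lookup σ (transpose a b x)
  lookup-∘⟨↔⟩ σ a b = lookup∘tabulate (lookup σ ∘ transpose a b)

  ∘⟨↔⟩-inverse : ∀ σ a b → (σ ∘⟨ a ↔ b ⟩) ∘⟨ b ↔ a ⟩ ≡ σ
  ∘⟨↔⟩-inverse σ a b = trans (tabulate-cong λ x → trans (lookup-∘⟨↔⟩ σ a b _) (cong (lookup σ) (transpose-inverse a b)))
                             (tabulate∘lookup σ)

  ∘⟨↔⟩-injective : ∀ σ a b → IsInjective σ → IsInjective (σ ∘⟨ a ↔ b ⟩)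
  ∘⟨↔⟩-injective σ a b injective {x} {y} eq = begin
    x                                   ≡⟨ transpose-inverse b a ⟨
    transpose b a (transpose a b x)     ≡⟨ cong (transpose b a) (injective (begin
      lookup σ (transpose a b x)          ≡⟨ lookup-∘⟨↔⟩ σ a b x ⟨
      lookup (σ ∘⟨ a ↔ b ⟩) x             ≡⟨ eq ⟩
      lookup (σ ∘⟨ a ↔ b ⟩) y             ≡⟨ lookup-∘⟨↔⟩ σ a b y ⟩
      lookup σ (transpose a b y)          ∎)) ⟩
    transpose b a (transpose a b y)     ≡⟨ transpose-inverse b a ⟩
    y                                   ∎
    where open ≡-Reasoning

  module Orbit (σ : Perm n) (injective : IsInjective σ) (j k : Fin n) (σk≡k : lookup σ k ≡ k) where

    τ : Perm n
    τ = σ ∘⟨ j ↔ k ⟩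

    τj≡k : lookup τ j ≡ k
    τj≡k = trans (lookup-∘⟨↔⟩ σ j k j) (trans (cong (lookup σ) (transpose-matchˡ j k)) σk≡k)

    τk≡σj : lookup τ k ≡ lookup σ j
    τk≡σj = trans (lookup-∘⟨↔⟩ σ j k k) (cong (lookup σ) (transpose-matchʳ j k))

    τ-other : ∀ {y} → y ≢ j → y ≢ k → lookup τ y ≡ lookup σ y
    τ-other y≢j y≢k = trans (lookup-∘⟨↔⟩ σ j k _) (cong (lookup σ) (transpose-other y≢j y≢k))

    τ-orbit : ∀ {i} → i ≢ k → ∀ m → (Σ ℕ λ m′ → iter τ m i ≡ iter σ m′ i)
                                   ⊎ (iter τ m i ≡ k × Σ ℕ λ m′ → iter σ m′ i ≡ j)
    τ-orbit i≢k zero = inj₁ (0 , refl)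
    τ-orbit {i} i≢k (suc m) with τ-orbit i≢k m
    ... | inj₂ (τᵐi≡k , m′ , σᵐ′i≡j) = inj₁ (suc m′ , trans (cong (lookup τ) τᵐi≡k) (trans τk≡σj (cong (lookup σ) (sym σᵐ′i≡j))))
    ... | inj₁ (m′ , τᵐi≡σᵐ′i) with iter σ m′ i Fin.≟ j | iter σ m′ i Fin.≟ k
    ...   | yes σᵐ′i≡j | _ = inj₂ (trans (cong (lookup τ) (trans τᵐi≡σᵐ′i σᵐ′i≡j)) τj≡k , m′ , σᵐ′i≡j)
    ...   | no _ | yes σᵐ′i≡k = ⊥-elim (i≢k (iter-injective σ injective m′ (trans σᵐ′i≡k (sym (iter-fixed σ σk≡k m′)))))
    ...   | no σᵐ′i≢j | no σᵐ′i≢k = inj₁ (suc m′ , trans (cong (lookup τ) τᵐi≡σᵐ′i) (τ-other σᵐ′i≢j σᵐ′i≢k))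

    σ-orbit : ∀ i m → Σ ℕ λ m′ → iter σ m i ≡ iter τ m′ i
    σ-orbit i zero = 0 , refl
    σ-orbit i (suc m) with σ-orbit i m | iter σ m i Fin.≟ j | iter σ m i Fin.≟ k
    ... | m′ , σᵐi≡τᵐ′i | yes σᵐi≡j | _ =
          suc (suc m′) , trans (cong (lookup σ) σᵐi≡j)
                         (trans (sym τk≡σj) (cong (lookup τ) (trans (sym τj≡k) (cong (lookup τ) (trans (sym σᵐi≡j) σᵐi≡τᵐ′i)))))
    ... | m′ , σᵐi≡τᵐ′i | no _ | yes σᵐi≡k = m′ , trans (cong (lookup σ) σᵐi≡k) (trans σk≡k (trans (sym σᵐi≡k) σᵐi≡τᵐ′i))
    ... | m′ , σᵐi≡τᵐ′i | no σᵐi≢j | no σᵐi≢k = suc m′ , trans (sym (τ-other σᵐi≢j σᵐi≢k)) (cong (lookup τ) σᵐi≡τᵐ′i)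

    τ-injective : IsInjective τ
    τ-injective = ∘⟨↔⟩-injective σ j k injective

    isCycleMin-τ : ∀ {i} → i ≢ k → toℕ j ≤ toℕ k → isCycleMin τ i ≡ isCycleMin σ i
    isCycleMin-τ {i} i≢k j≤k = T-≡ (isCycleMin⁺ σ ∘ from-τ ∘ isCycleMin⁻ τ τ-injective)
                                    (isCycleMin⁺ τ ∘ from-σ ∘ isCycleMin⁻ σ injective)
      where
      from-τ : IsCycleMin τ i → IsCycleMin σ i
      from-τ min m with σ-orbit i m
      ... | m′ , eq = subst (λ x → toℕ i ≤ toℕ x) (sym eq) (min m′)
      from-σ : IsCycleMin σ i → IsCycleMin τ i
      from-σ min m with τ-orbit i≢k m
      ... | inj₁ (m′ , eq) = subst (λ x → toℕ i ≤ toℕ x) (sym eq) (min m′)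
      ... | inj₂ (eq , m′ , σᵐ′i≡j) = subst (λ x → toℕ i ≤ toℕ x) (sym eq)
                                        (≤-trans (subst (λ x → toℕ i ≤ toℕ x) σᵐ′i≡j (min m′)) j≤k)

    isCycleMin-τ-k : toℕ j ≤ toℕ k → isCycleMin τ k ≡ does (j Fin.≟ k)
    isCycleMin-τ-k j≤k with j Fin.≟ k
    ... | yes refl = isCycleMin⁺-true
      where
      isCycleMin⁺-true : isCycleMin τ j ≡ true
      isCycleMin⁺-true = T-≡ (λ _ → _) (λ _ → isCycleMin⁺ τ λ m → ≤-reflexive (cong toℕ (sym (iter-fixed τ τj≡k m))))
    ... | no j≢k = T-≡ (λ min → j≢k (toℕ-injective (≤-antisym j≤k (back-to-j (isCycleMin⁻ τ τ-injective min))))) (λ ())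
      where
      back-to-j : IsCycleMin τ k → toℕ k ≤ toℕ j
      back-to-j min with period τ τ-injective j
      ... | suc p , _ , _ , τᵖ⁺¹j≡j = subst (λ x → toℕ k ≤ toℕ x) (trans (cong (iter τ p) (sym τj≡k)) (trans (sym (iter-suc τ p j)) τᵖ⁺¹j≡j)) (min p)

module _ {n : ℕ} where

  fixesFrom : ℕ → Perm n → Bool
  fixesFrom k σ = all (λ x → (toℕ x <ᵇ k) ∨ (toℕ (lookup σ x) ≡ᵇ toℕ x)) (allFin n)

  FixesFrom : ℕ → Perm n → Set
  FixesFrom k σ = ∀ x → k ≤ toℕ x → lookup σ x ≡ x

  fixesFrom⁻ : ∀ {k} σ → T (fixesFrom k σ) → FixesFrom k σ
  fixesFrom⁻ σ ok x k≤x with Equivalence.to T-∨ (tabulate⁻ (all⁺ _ _ ok) x)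
  ... | inj₁ x<k   = ⊥-elim (<⇒≱ (<ᵇ⇒< _ _ x<k) k≤x)
  ... | inj₂ σx≡x  = toℕ-injective (≡ᵇ⇒≡ _ _ σx≡x)

  fixesFrom⁺ : ∀ {k} σ → FixesFrom k σ → T (fixesFrom k σ)
  fixesFrom⁺ {k} σ fixes = all⁻ _ (tabulate⁺ λ x → Equivalence.from T-∨ (case x))
    where
    case : ∀ x → T (toℕ x <ᵇ k) ⊎ T (toℕ (lookup σ x) ≡ᵇ toℕ x)
    case x with toℕ x <? k
    ... | yes x<k = inj₁ (<⇒<ᵇ x<k)
    ... | no x≮k  = inj₂ (≡⇒≡ᵇ _ _ (cong toℕ (fixes x (≮⇒≥ x≮k))))

  inSym : ℕ → Perm n → Bool
  inSym k σ = isPerm σ ∧ fixesFrom k σ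

  inSym⁻ : ∀ {k} σ → T (inSym k σ) → T (isPerm σ) × FixesFrom k σ
  inSym⁻ σ ok = proj₁ (T-∧⁻ ok) , fixesFrom⁻ σ (proj₂ (T-∧⁻ ok))

  inSym⁺ : ∀ {k} σ → T (isPerm σ) → FixesFrom k σ → T (inSym k σ)
  inSym⁺ σ perm fixes = T-∧⁺ perm (fixesFrom⁺ σ fixes)

  countSym : ℕ → (Perm n → Bool) → ℕ
  countSym k W = ∑[ σ ∈ allMaps n ] 𝟙 (inSym k σ ∧ W σ)

  module Step (k : ℕ) (k<n : k < n) where

    k̂ : Fin n
    k̂ = Fin.fromℕ< k<n

    k̂≡k : toℕ k̂ ≡ k
    k̂≡k = toℕ-fromℕ< k<n

    module Swap (σ : Perm n) (j : Fin n) where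

      τ : Perm n
      τ = σ ∘⟨ j ↔ k̂ ⟩

      τj≡σk̂ : lookup τ j ≡ lookup σ k̂
      τj≡σk̂ = trans (lookup-∘⟨↔⟩ σ j k̂ j) (cong (lookup σ) (transpose-matchˡ j k̂))

      τ-above : ∀ {x} → k < toℕ x → toℕ j ≤ k → lookup τ x ≡ lookup σ x
      τ-above k<x j≤k = trans (lookup-∘⟨↔⟩ σ j k̂ _)
        (cong (lookup σ) (transpose-other (λ { refl → <⇒≱ k<x j≤k }) (λ { refl → <-irrefl (sym k̂≡k) k<x })))

      descend : T (isPerm τ) → FixesFrom (suc k) τ → lookup τ j ≡ k̂ → toℕ j ≤ k × T (isPerm σ) × FixesFrom k σ
      descend τ-perm τ-fixes τj≡k̂ = j≤k , σ-perm , σ-fixes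
        where
        j≤k : toℕ j ≤ k
        j≤k with toℕ j ≤? k
        ... | yes j≤k = j≤k
        ... | no j≰k  = ⊥-elim (<-irrefl (trans (sym k̂≡k) (cong toℕ (trans (sym τj≡k̂) (τ-fixes j (≰⇒> j≰k))))) (≰⇒> j≰k))
        σ-perm : T (isPerm σ)
        σ-perm = subst (T ∘ isPerm) (∘⟨↔⟩-inverse σ j k̂) (isPerm⁺ (τ ∘⟨ k̂ ↔ j ⟩) (∘⟨↔⟩-injective τ k̂ j (isPerm⁻ τ τ-perm)))
        σ-fixes : FixesFrom k σ
        σ-fixes x k≤x with k <? toℕ x
        ... | yes k<x = trans (sym (τ-above k<x j≤k)) (τ-fixes x k<x)
        ... | no k≮x  with refl ← toℕ-injective {i = x} {j = k̂} (trans (≤-antisym (≮⇒≥ k≮x) k≤x) (sym k̂≡k)) =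
                trans (sym τj≡σk̂) τj≡k̂

      ascend : toℕ j ≤ k → T (isPerm σ) → FixesFrom k σ → T (isPerm τ) × FixesFrom (suc k) τ × lookup τ j ≡ k̂
      ascend j≤k σ-perm σ-fixes =
        isPerm⁺ τ (∘⟨↔⟩-injective σ j k̂ (isPerm⁻ σ σ-perm)) ,
        (λ x k<x → trans (τ-above k<x j≤k) (σ-fixes x (<⇒≤ k<x))) ,
        trans τj≡σk̂ (σ-fixes k̂ (≤-reflexive (sym k̂≡k)))

    inSym-∘⟨↔⟩ : ∀ σ j → (inSym (suc k) (σ ∘⟨ j ↔ k̂ ⟩) ∧ does (lookup (σ ∘⟨ j ↔ k̂ ⟩) j Fin.≟ k̂)) ≡ ((toℕ j ≤ᵇ k) ∧ inSym k σ)
    inSym-∘⟨↔⟩ σ j = T-≡ to from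
      where
      open Swap σ j
      to : T (inSym (suc k) τ ∧ does (lookup τ j Fin.≟ k̂)) → T ((toℕ j ≤ᵇ k) ∧ inSym k σ)
      to ok with T-∧⁻ ok
      ... | τ∈S , τj≡k̂ with inSym⁻ τ τ∈S
      ...   | τ-perm , τ-fixes with descend τ-perm τ-fixes (T-does⁻ (lookup τ j Fin.≟ k̂) τj≡k̂)
      ...     | j≤k , σ-perm , σ-fixes = T-∧⁺ (≤⇒≤ᵇ j≤k) (inSym⁺ σ σ-perm σ-fixes)
      from : T ((toℕ j ≤ᵇ k) ∧ inSym k σ) → T (inSym (suc k) τ ∧ does (lookup τ j Fin.≟ k̂))
      from ok with T-∧⁻ ok
      ... | j≤k , σ∈S with inSym⁻ σ σ∈S
      ...   | σ-perm , σ-fixes with ascend (≤ᵇ⇒≤ _ _ j≤k) σ-perm σ-fixes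
      ...     | τ-perm , τ-fixes , τj≡k̂ = T-∧⁺ (inSym⁺ τ τ-perm τ-fixes) (T-does⁺ (lookup τ j Fin.≟ k̂) τj≡k̂)

    step : ∀ W → countSym (suc k) W ≡ ∑[ j ∈ allFin n ] (𝟙 (toℕ j ≤ᵇ k) * countSym k (λ σ → W (σ ∘⟨ j ↔ k̂ ⟩)))
    step W = begin
      countSym (suc k) W
        ≡⟨ ∑-cong (allMaps n) split-by-preimage ⟩
      ∑[ τ ∈ allMaps n ] ∑[ j ∈ allFin n ] 𝟙 ((inSym (suc k) τ ∧ W τ) ∧ does (lookup τ j Fin.≟ k̂))
        ≡⟨ ∑-comm (λ τ j → 𝟙 ((inSym (suc k) τ ∧ W τ) ∧ does (lookup τ j Fin.≟ k̂))) (allMaps n) (allFin n) ⟩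
      ∑[ j ∈ allFin n ] ∑[ τ ∈ allMaps n ] 𝟙 ((inSym (suc k) τ ∧ W τ) ∧ does (lookup τ j Fin.≟ k̂))
        ≡⟨ ∑-cong (allFin n) (λ j → sym (∑-reindex (≡-dec Fin._≟_) {allMaps n} allMaps-enumerates
                                           (_∘⟨ j ↔ k̂ ⟩) (_∘⟨ k̂ ↔ j ⟩) (λ σ → ∘⟨↔⟩-inverse σ j k̂) (λ τ → ∘⟨↔⟩-inverse τ k̂ j)
                                           (λ τ → 𝟙 ((inSym (suc k) τ ∧ W τ) ∧ does (lookup τ j Fin.≟ k̂))))) ⟩
      ∑[ j ∈ allFin n ] ∑[ σ ∈ allMaps n ] 𝟙 ((inSym (suc k) (σ ∘⟨ j ↔ k̂ ⟩) ∧ W (σ ∘⟨ j ↔ k̂ ⟩)) ∧ does (lookup (σ ∘⟨ j ↔ k̂ ⟩) j Fin.≟ k̂))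
        ≡⟨ ∑-cong (allFin n) (λ j → trans (∑-cong (allMaps n) (regroup j)) (sym (*-distribˡ-∑ (𝟙 (toℕ j ≤ᵇ k)) _ (allMaps n)))) ⟩
      ∑[ j ∈ allFin n ] (𝟙 (toℕ j ≤ᵇ k) * countSym k (λ σ → W (σ ∘⟨ j ↔ k̂ ⟩))) ∎
      where
      open ≡-Reasoning
      allMaps-enumerates : Enumerates (≡-dec Fin._≟_) (allMaps n)
      allMaps-enumerates = allVecs-enumerates (allFin-enumerates n) n
      split-by-preimage : ∀ τ → 𝟙 (inSym (suc k) τ ∧ W τ) ≡ ∑[ j ∈ allFin n ] 𝟙 ((inSym (suc k) τ ∧ W τ) ∧ does (lookup τ j Fin.≟ k̂))
      split-by-preimage τ with inSym (suc k) τ ∧ W τ in eq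
      ... | false = sym (∑-zero (allFin n))
      ... | true  = sym (multiplicity-image τ (isPerm⁻ τ τ-perm) k̂)
        where τ-perm = proj₁ (inSym⁻ {suc k} τ (proj₁ (T-∧⁻ (subst T (sym eq) _))))
      ∧-swapʳ : ∀ a b c → (a ∧ b) ∧ c ≡ (a ∧ c) ∧ b
      ∧-swapʳ true  b c = ∧-comm b c
      ∧-swapʳ false b c = refl
      regroup : ∀ j σ → 𝟙 ((inSym (suc k) (σ ∘⟨ j ↔ k̂ ⟩) ∧ W (σ ∘⟨ j ↔ k̂ ⟩)) ∧ does (lookup (σ ∘⟨ j ↔ k̂ ⟩) j Fin.≟ k̂))
                      ≡ 𝟙 (toℕ j ≤ᵇ k) * 𝟙 (inSym k σ ∧ W (σ ∘⟨ j ↔ k̂ ⟩))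
      regroup j σ = trans (cong 𝟙 (trans (∧-swapʳ (inSym (suc k) (σ ∘⟨ j ↔ k̂ ⟩)) _ _)
                                  (trans (cong (_∧ W (σ ∘⟨ j ↔ k̂ ⟩)) (inSym-∘⟨↔⟩ σ j)) (∧-assoc (toℕ j ≤ᵇ k) _ _))))
                          (𝟙-∧ (toℕ j ≤ᵇ k) _)

  countSym-cong : ∀ k {W₁ W₂ : Perm n → Bool} → (∀ σ → T (isPerm σ) → FixesFrom k σ → W₁ σ ≡ W₂ σ) →
                countSym k W₁ ≡ countSym k W₂
  countSym-cong k {W₁} {W₂} W₁≗W₂ = ∑-cong (allMaps n) pointwise
    where
    pointwise : ∀ σ → 𝟙 (inSym k σ ∧ W₁ σ) ≡ 𝟙 (inSym k σ ∧ W₂ σ)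
    pointwise σ with isPerm σ in perm | fixesFrom k σ in fixes
    ... | true  | true  = cong 𝟙 (W₁≗W₂ σ (subst T (sym perm) _) (fixesFrom⁻ σ (subst T (sym fixes) _)))
    ... | true  | false = refl
    ... | false | _     = refl

  countSym-const : ∀ k b → countSym k (λ _ → b) ≡ 𝟙 b * countSym k (λ _ → true)
  countSym-const k b = trans (∑-cong (allMaps n) pointwise) (sym (*-distribˡ-∑ (𝟙 b) _ (allMaps n)))
    where
    pointwise : ∀ σ → 𝟙 (inSym k σ ∧ b) ≡ 𝟙 b * 𝟙 (inSym k σ ∧ true)
    pointwise σ with inSym k σ
    ... | true  = sym (*-identityʳ (𝟙 b))
    ... | false = sym (*-zeroʳ (𝟙 b))

  ∑-≤ᵇ : ∀ {k} → k < n → ∑[ j ∈ allFin n ] 𝟙 (toℕ j ≤ᵇ k) ≡ suc k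
  ∑-≤ᵇ {k} k<n = trans (∑-allFin n (λ j → 𝟙 (j ≤ᵇ k)))
                       (trans (∑<-cong n (λ j _ → cong 𝟙 (≤ᵇ≡<ᵇ-suc j)))
                              (trans (∑<-𝟙-< n (suc k)) (m≥n⇒m⊓n≡n k<n)))
    where
    ≤ᵇ≡<ᵇ-suc : ∀ j → (j ≤ᵇ k) ≡ (j <ᵇ suc k)
    ≤ᵇ≡<ᵇ-suc zero    = refl
    ≤ᵇ≡<ᵇ-suc (suc j) = refl

  symCount : ℕ → ℕ
  symCount k = countSym k (λ _ → true)

  symCount-zero : symCount 0 ≡ 1
  symCount-zero = trans (∑-cong (allMaps n) only-identity)
                         (allVecs-enumerates (allFin-enumerates n) n identity)
    where
    identity : Perm n
    identity = Vec.tabulate id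
    lookup-identity : ∀ x → lookup identity x ≡ x
    lookup-identity = lookup∘tabulate id
    only-identity : ∀ σ → 𝟙 (inSym 0 σ ∧ true) ≡ 𝟙 (does (≡-dec Fin._≟_ σ identity))
    only-identity σ = cong 𝟙 (T-≡ to from)
      where
      to : T (inSym 0 σ ∧ true) → T (does (≡-dec Fin._≟_ σ identity))
      to ok = T-does⁺ (≡-dec Fin._≟_ σ identity)
        (trans (sym (tabulate∘lookup σ)) (tabulate-cong λ x → proj₂ (inSym⁻ σ (proj₁ (T-∧⁻ ok))) x z≤n))
      from : T (does (≡-dec Fin._≟_ σ identity)) → T (inSym 0 σ ∧ true)
      from is-id with refl ← T-does⁻ (≡-dec Fin._≟_ σ identity) is-id =
        T-∧⁺ (inSym⁺ {0} identity (isPerm⁺ identity identity-injective) (λ x _ → lookup-identity x)) _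
        where
        identity-injective : IsInjective identity
        identity-injective {x} {y} eq = trans (sym (lookup-identity x)) (trans eq (lookup-identity y))

  symCount-suc : ∀ {k} → k < n → symCount (suc k) ≡ suc k * symCount k
  symCount-suc {k} k<n = begin
    symCount (suc k)                                     ≡⟨ Step.step k k<n (λ _ → true) ⟩
    ∑[ j ∈ allFin n ] (𝟙 (toℕ j ≤ᵇ k) * symCount k)     ≡⟨ *-distribʳ-∑ (symCount k) (λ j → 𝟙 (toℕ j ≤ᵇ k)) (allFin n) ⟨
    ∑[ j ∈ allFin n ] 𝟙 (toℕ j ≤ᵇ k) * symCount k       ≡⟨ cong (_* symCount k) (∑-≤ᵇ k<n) ⟩
    suc k * symCount k                                   ∎
    where open ≡-Reasoning

  symCount≡! : ∀ {k} → k ≤ n → symCount k ≡ k !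
  symCount≡! {zero}  _   = symCount-zero
  symCount≡! {suc k} k<n = trans (symCount-suc k<n) (cong (suc k *_) (symCount≡! (<⇒≤ k<n)))

  nonMinCount : Fin n → ℕ → ℕ
  nonMinCount i k = countSym k (λ σ → not (isCycleMin σ i))

  module _ {k : ℕ} (k<n : k < n) where
    open Step k k<n

    nonMinCount-suc : ∀ {i} → i ≢ k̂ → nonMinCount i (suc k) ≡ suc k * nonMinCount i k
    nonMinCount-suc {i} i≢k̂ = begin
      nonMinCount i (suc k)
        ≡⟨ step (λ σ → not (isCycleMin σ i)) ⟩
      ∑[ j ∈ allFin n ] (𝟙 (toℕ j ≤ᵇ k) * countSym k (λ σ → not (isCycleMin (σ ∘⟨ j ↔ k̂ ⟩) i)))
        ≡⟨ ∑-cong (allFin n) (λ j → 𝟙*-cong (toℕ j ≤ᵇ k) λ j≤k → countSym-cong k λ σ perm fixes →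
             cong not (Orbit.isCycleMin-τ σ (isPerm⁻ σ perm) j k̂ (fixes k̂ (≤-reflexive (sym k̂≡k))) i≢k̂
                                           (subst (toℕ j ≤_) (sym k̂≡k) (≤ᵇ⇒≤ _ _ j≤k)))) ⟩
      ∑[ j ∈ allFin n ] (𝟙 (toℕ j ≤ᵇ k) * nonMinCount i k)
        ≡⟨ *-distribʳ-∑ (nonMinCount i k) (λ j → 𝟙 (toℕ j ≤ᵇ k)) (allFin n) ⟨
      ∑[ j ∈ allFin n ] 𝟙 (toℕ j ≤ᵇ k) * nonMinCount i k
        ≡⟨ cong (_* nonMinCount i k) (∑-≤ᵇ k<n) ⟩
      suc k * nonMinCount i k ∎
      where open ≡-Reasoning

    ∑-below-k̂ : ∑[ j ∈ allFin n ] (𝟙 (toℕ j ≤ᵇ k) * 𝟙 (not (does (j Fin.≟ k̂)))) ≡ k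
    ∑-below-k̂ = trans (∑-cong (allFin n) below) (trans (∑-allFin n (λ j → 𝟙 (j <ᵇ k)))
                                                 (trans (∑<-𝟙-< n k) (m≥n⇒m⊓n≡n (<⇒≤ k<n))))
      where
      below : ∀ j → 𝟙 (toℕ j ≤ᵇ k) * 𝟙 (not (does (j Fin.≟ k̂))) ≡ 𝟙 (toℕ j <ᵇ k)
      below j with j Fin.≟ k̂
      ... | yes refl = trans (*-zeroʳ (𝟙 (toℕ k̂ ≤ᵇ k))) (sym (𝟙-¬T (<-irrefl k̂≡k ∘ <ᵇ⇒< _ _)))
      ... | no j≢k̂  = trans (*-identityʳ _) (cong 𝟙 (T-≡
                        (λ j≤k → <⇒<ᵇ (≤∧≢⇒< (≤ᵇ⇒≤ _ _ j≤k) (λ j≡k → j≢k̂ (toℕ-injective (trans j≡k (sym k̂≡k))))))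
                        (λ j<k → ≤⇒≤ᵇ (<⇒≤ (<ᵇ⇒< (toℕ j) k j<k)))))

    nonMinCount-k̂ : nonMinCount k̂ (suc k) ≡ k * symCount k
    nonMinCount-k̂ = begin
      nonMinCount k̂ (suc k)
        ≡⟨ step (λ σ → not (isCycleMin σ k̂)) ⟩
      ∑[ j ∈ allFin n ] (𝟙 (toℕ j ≤ᵇ k) * countSym k (λ σ → not (isCycleMin (σ ∘⟨ j ↔ k̂ ⟩) k̂)))
        ≡⟨ ∑-cong (allFin n) (λ j → 𝟙*-cong (toℕ j ≤ᵇ k) λ j≤k → trans (countSym-cong k λ σ perm fixes →
             cong not (Orbit.isCycleMin-τ-k σ (isPerm⁻ σ perm) j k̂ (fixes k̂ (≤-reflexive (sym k̂≡k)))
                                             (subst (toℕ j ≤_) (sym k̂≡k) (≤ᵇ⇒≤ _ _ j≤k))))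
             (countSym-const k (not (does (j Fin.≟ k̂))))) ⟩
      ∑[ j ∈ allFin n ] (𝟙 (toℕ j ≤ᵇ k) * (𝟙 (not (does (j Fin.≟ k̂))) * symCount k))
        ≡⟨ ∑-cong (allFin n) (λ j → sym (*-assoc (𝟙 (toℕ j ≤ᵇ k)) _ (symCount k))) ⟩
      ∑[ j ∈ allFin n ] (𝟙 (toℕ j ≤ᵇ k) * 𝟙 (not (does (j Fin.≟ k̂))) * symCount k)
        ≡⟨ *-distribʳ-∑ (symCount k) (λ j → 𝟙 (toℕ j ≤ᵇ k) * 𝟙 (not (does (j Fin.≟ k̂)))) (allFin n) ⟨
      ∑[ j ∈ allFin n ] (𝟙 (toℕ j ≤ᵇ k) * 𝟙 (not (does (j Fin.≟ k̂)))) * symCount k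
        ≡⟨ cong (_* symCount k) ∑-below-k̂ ⟩
      k * symCount k ∎
      where open ≡-Reasoning

  nonMinCount≡factorialReplacing : ∀ i {m} → toℕ i < m → m ≤ n → nonMinCount i m ≡ factorialReplacing m (toℕ i)
  nonMinCount≡factorialReplacing i {suc m} i<1+m m<n with toℕ i ≟ m
  ... | yes i≡m = begin
    nonMinCount i (suc m)                                  ≡⟨ cong (λ x → nonMinCount x (suc m)) i≡m̂ ⟩
    nonMinCount m̂ (suc m)                                  ≡⟨ nonMinCount-k̂ m<n ⟩
    m * symCount m                                        ≡⟨ cong (m *_) (symCount≡! (<⇒≤ m<n)) ⟩
    m * m !                                                ≡⟨ *-comm m (m !) ⟩
    m ! * m                                                ≡⟨ cong₂ _*_ (sym (∏-suc≡! m)) (sym (replaceFactor-at m)) ⟩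
    ∏[ k < m ] suc k * replaceFactor m m                   ≡⟨ cong (_* replaceFactor m m) (∏<-cong m λ k k<m → sym (replaceFactor-≢ (<⇒≢ k<m))) ⟩
    factorialReplacing (suc m) m                           ≡⟨ cong (factorialReplacing (suc m)) i≡m ⟨
    factorialReplacing (suc m) (toℕ i)                     ∎
    where
    open ≡-Reasoning
    m̂ = Step.k̂ m m<n
    i≡m̂ : i ≡ m̂
    i≡m̂ = toℕ-injective (trans i≡m (sym (Step.k̂≡k m m<n)))
  ... | no i≢m = begin
    nonMinCount i (suc m)                                  ≡⟨ nonMinCount-suc m<n (λ i≡m̂ → i≢m (trans (cong toℕ i≡m̂) (Step.k̂≡k m m<n))) ⟩
    suc m * nonMinCount i m                                ≡⟨ cong (suc m *_) (nonMinCount≡factorialReplacing i i<m (<⇒≤ m<n)) ⟩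
    suc m * factorialReplacing m (toℕ i)                   ≡⟨ *-comm (suc m) _ ⟩
    factorialReplacing m (toℕ i) * suc m                   ≡⟨ cong (factorialReplacing m (toℕ i) *_) (replaceFactor-≢ (i≢m ∘ sym)) ⟨
    factorialReplacing (suc m) (toℕ i)                     ∎
    where
    open ≡-Reasoning
    i<m = ≤∧≢⇒< (s≤s⁻¹ i<1+m) i≢m

module _ {m : ℕ} where

  private n = suc m

  non-cycleMins : Perm n → ℕ
  non-cycleMins σ = ∑[ i ∈ allFin n ] 𝟙 (not (isCycleMin σ i))

  cycles+non-cycleMins : ∀ σ → numCycles σ + non-cycleMins σ ≡ n
  cycles+non-cycleMins σ = trans (cong (_+ non-cycleMins σ) (count≡∑𝟙 (isCycleMin σ) (allFin n)))
                                 (∑-allFin-complement n (isCycleMin σ))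

  0<cycles : ∀ σ → 0 < numCycles σ
  0<cycles σ = subst (0 <_) (sym (count≡∑𝟙 (isCycleMin σ) (allFin n)))
                     (subst (λ x → 0 < x + ∑[ i ∈ tabulate Fin.suc ] 𝟙 (isCycleMin σ i))
                            (sym (𝟙-T (isCycleMin⁺ σ λ _ → z≤n))) (s≤s z≤n))

  ∑-weighted-cycles : ∀ σ → ∑[ k < n ] ((n ∸ suc k) * 𝟙 (numCycles σ ≡ᵇ suc k)) ≡ non-cycleMins σ
  ∑-weighted-cycles σ with numCycles σ | 0<cycles σ | cycles+non-cycleMins σ
  ... | suc c | _ | c+rest≡n = begin
    ∑[ k < n ] ((n ∸ suc k) * 𝟙 (suc c ≡ᵇ suc k))   ≡⟨ ∑<-single n _ c<n (λ k _ k≢c →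
                                                         trans (cong ((n ∸ suc k) *_) (𝟙-¬T (k≢c ∘ sym ∘ ≡ᵇ⇒≡ c k)))
                                                               (*-zeroʳ (n ∸ suc k))) ⟩
    (n ∸ suc c) * 𝟙 (c ≡ᵇ c)                        ≡⟨ trans (cong ((n ∸ suc c) *_) (𝟙-T (≡⇒≡ᵇ c c refl))) (*-identityʳ _) ⟩
    n ∸ suc c                                       ≡⟨ cong (_∸ suc c) c+rest≡n ⟨
    suc c + non-cycleMins σ ∸ suc c                 ≡⟨ m+n∸m≡n (suc c) _ ⟩
    non-cycleMins σ                                 ∎
    where
    open ≡-Reasoning
    c<n : c < n
    c<n = subst (c <_) c+rest≡n (s≤s (m≤m+n c _))

  count-non-cycleMin : ∀ i → ∑[ σ ∈ allMaps n ] 𝟙 (isPerm σ ∧ not (isCycleMin σ i)) ≡ factorialReplacing n (toℕ i)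
  count-non-cycleMin i = trans (∑-cong (allMaps n) fixes-everything) (nonMinCount≡factorialReplacing i (toℕ<n i) ≤-refl)
    where
    fixes-everything : ∀ σ → 𝟙 (isPerm σ ∧ not (isCycleMin σ i)) ≡ 𝟙 (inSym n σ ∧ not (isCycleMin σ i))
    fixes-everything σ = cong (λ b → 𝟙 (b ∧ not (isCycleMin σ i)))
      (sym (trans (cong (isPerm σ ∧_) (T-≡ (λ _ → _) (λ _ → fixesFrom⁺ σ λ x n≤x → ⊥-elim (<⇒≱ (toℕ<n x) n≤x))))
                  (∧-identityʳ (isPerm σ))))

  rhs≡∑factorialReplacing : rhs n ≡ ∑[ i < n ] factorialReplacing n i
  rhs≡∑factorialReplacing = begin
    rhs n
      ≡⟨ sum-map-applyUpTo (λ k → (n ∸ k) * c n k) suc n ⟩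
    ∑[ k < n ] ((n ∸ suc k) * c n (suc k))
      ≡⟨ ∑<-cong n (λ k _ → trans (cong ((n ∸ suc k) *_) (count≡∑𝟙 _ (allMaps n))) (*-distribˡ-∑ (n ∸ suc k) _ (allMaps n))) ⟩
    ∑[ k < n ] ∑[ σ ∈ allMaps n ] ((n ∸ suc k) * 𝟙 (isPerm σ ∧ (numCycles σ ≡ᵇ suc k)))
      ≡⟨ ∑-∑<-comm n (λ k σ → (n ∸ suc k) * 𝟙 (isPerm σ ∧ (numCycles σ ≡ᵇ suc k))) (allMaps n) ⟨
    ∑[ σ ∈ allMaps n ] ∑[ k < n ] ((n ∸ suc k) * 𝟙 (isPerm σ ∧ (numCycles σ ≡ᵇ suc k)))
      ≡⟨ ∑-cong (allMaps n) per-permutation ⟩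
    ∑[ σ ∈ allMaps n ] ∑[ i ∈ allFin n ] 𝟙 (isPerm σ ∧ not (isCycleMin σ i))
      ≡⟨ ∑-comm (λ σ i → 𝟙 (isPerm σ ∧ not (isCycleMin σ i))) (allMaps n) (allFin n) ⟩
    ∑[ i ∈ allFin n ] ∑[ σ ∈ allMaps n ] 𝟙 (isPerm σ ∧ not (isCycleMin σ i))
      ≡⟨ ∑-cong (allFin n) count-non-cycleMin ⟩
    ∑[ i ∈ allFin n ] factorialReplacing n (toℕ i)
      ≡⟨ ∑-allFin n (factorialReplacing n) ⟩
    ∑[ i < n ] factorialReplacing n i ∎
    where
    open ≡-Reasoning
    per-permutation : ∀ σ → ∑[ k < n ] ((n ∸ suc k) * 𝟙 (isPerm σ ∧ (numCycles σ ≡ᵇ suc k)))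
                          ≡ ∑[ i ∈ allFin n ] 𝟙 (isPerm σ ∧ not (isCycleMin σ i))
    per-permutation σ with isPerm σ
    ... | true  = ∑-weighted-cycles σ
    ... | false = trans (∑<-vanish n λ k _ → *-zeroʳ (n ∸ suc k)) (sym (∑-zero (allFin n)))

corollary2p9 : (n : ℕ) → 1 ≤ n → R n (n ∸ 1) ≡ rhs n
corollary2p9 (suc m) _ = trans (R≡∑factorialReplacing m) (sym (rhs≡∑factorialReplacing {m}))
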